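{- Let $r,s$ be positive integers. An $r$-colored partition is a finite multiset of colored parts $j_c$ ($j\ge1$, $c\in\{1,\dots,r\}$). A colored overpartition of $n$ is a pair $(\lambda,\mu)$ where $\lambda$ is an $r$-colored partition of some $m$ and $\mu$ is an $s$-colored partition of $n-m$ into distinct parts (a finite set of colored parts $j_c$, $c\in\{1,\dots,s\}$, each colored part at most once), $0\le m\le n$. A colored odd-overlined partition of $n$ is a pair $(\lambda,\nu)$ where $\lambda$ is an $r$-colored partition of some $m$ and $\nu$ is an $s$-colored partition of $n-m$ into odd parts (a finite multiset of colored parts $j_c$, $j$ odd, $c\in\{1,\dots,s\}$). Define, for positive integers $k,n$: - $F_k(n)$: the total number of parts of size $k$ in the component $\lambda$, summed over all colored overpartitions $(\lambda,\mu)$ of $n$; - $G_k(n)$: the total number of distinct colored parts of $\lambda$ occurring at least $k$ times in $\lambda$, summed over all colored overpartitions $(\lambda,\mu)$ of $n$; - $F^d_k(n)$: the total number of parts of size $k$ in the component $\mu$, summed over all colored overpartitions $(\lambda,\mu)$ of $n$; - $F^o_k(n)$: the total number of parts of size $k$ in the component $\nu$, summed over all colored odd-overlined partitions $(\lambda,\nu)$ of $n$; - $G^o_k(n)$: the total number of distinct colored parts of $\nu$ occurring at least $k$ times in $\nu$, summed over all colored odd-overlined partitions $(\lambda,\nu)$ of $n$; with $G^o_k(m)=0$ for $m\le0$. Then for all $n=1,2,\dots$: $F_k(n)=G_k(n)$ for $k=1,2,3,\dots$; $F^d_k(n)=G^o_k(n)-G^o_k(n-k)$ for $k=1,2,3,\dots$;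 $F^o_k(n)=G^o_k(n)+G^o_k(n-k)$ for $k=1,3,5,\dots$.
   Context: Both colored overpartitions and colored odd-overlined partitions of $n$ are counted by the coefficient of $q^n$ in $\prod_{k\ge1}\frac{(1+q^k)^s}{(1-q^k)^r}=\prod_{k\ge1}\frac{1}{(1-q^k)^r(1-q^{2k-1})^s}$. -}

module Defs where

open import Data.Nat using (ℕ; zero; suc; _+_; _*_; _∸_; _≤_; _<_; _<ᵇ_; _≤ᵇ_; _≡ᵇ_)
open import Data.Bool using (Bool; true; false; if_then_else_; _∧_)
open import Data.List using (List; []; _∷_; map; concatMap; filterᵇ; upTo)
open import Data.Nat.ListAction using (sum)
open import Data.Vec using (Vec; []; _∷_)
open import Data.Product using (_×_; _,_)

-- A colored partition with parts of size ≤ N and colors in {1..r} is a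
-- table  M : Vec (Vec ℕ r) N  where the entry in row i (0-based) and
-- column c is the multiplicity of the colored part (i+1)_c.
-- (A finite multiset of colored parts = its multiplicity function.)

Table : ℕ → ℕ → Set
Table N r = Vec (Vec ℕ r) N

allVec : {A : Set} → List A → (len : ℕ) → List (Vec A len)
allVec xs zero    = [] ∷ []
allVec xs (suc l) = concatMap (λ x → map (x ∷_) (allVec xs l)) xs

allTables : (N r b : ℕ) → List (Table N r)
allTables N r b = allVec (allVec (upTo (suc b)) r) N

vsum : {n : ℕ} → Vec ℕ n → ℕ
vsum []       = 0
vsum (x ∷ xs) = x + vsum xs

weightFrom : {N r : ℕ} → ℕ → Table N r → ℕ
weightFrom off []           = 0
weightFrom off (row ∷ rows) = suc off * vsum row + weightFrom (suc off) rows

weight : {N r : ℕ} → Table N r → ℕ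
weight = weightFrom 0

partsOfSizeFrom : {N r : ℕ} → ℕ → ℕ → Table N r → ℕ
partsOfSizeFrom k off []           = 0
partsOfSizeFrom k off (row ∷ rows) =
  (if suc off ≡ᵇ k then vsum row else 0) + partsOfSizeFrom k (suc off) rows

partsOfSize : {N r : ℕ} → ℕ → Table N r → ℕ
partsOfSize k = partsOfSizeFrom k 0

countAtLeast : {n : ℕ} → ℕ → Vec ℕ n → ℕ
countAtLeast k []       = 0
countAtLeast k (x ∷ xs) = (if k ≤ᵇ x then 1 else 0) + countAtLeast k xs

distinctAtLeast : {N r : ℕ} → ℕ → Table N r → ℕ
distinctAtLeast k []           = 0
distinctAtLeast k (row ∷ rows) = countAtLeast k row + distinctAtLeast k rows

allZero : {n : ℕ} → Vec ℕ n → Bool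
allZero []       = true
allZero (x ∷ xs) = (x ≡ᵇ 0) ∧ allZero xs

oddPartsFrom : {N r : ℕ} → ℕ → Table N r → Bool
oddPartsFrom off []           = true
oddPartsFrom off (row ∷ rows) =
  (if oddᵇ (suc off) then true else allZero row) ∧ oddPartsFrom (suc off) rows
  where
    oddᵇ : ℕ → Bool
    oddᵇ zero          = false
    oddᵇ (suc zero)    = true
    oddᵇ (suc (suc m)) = oddᵇ m

oddParts : {N r : ℕ} → Table N r → Bool
oddParts = oddPartsFrom 0

-- Since every part is ≥ 1, part sizes and
-- multiplicities are ≤ n, so bounding tables by n loses nothing.

pairs : {A B : Set} → List A → List B → List (A × B)
pairs as bs = concatMap (λ a → map (a ,_) bs) as

overpartitions : (r s n : ℕ) → List (Table n r × Table n s)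
overpartitions r s n =
  filterᵇ (λ { (l , m) → (weight l + weight m) ≡ᵇ n })
    (pairs (allTables n r n) (allTables n s 1))

oddOverlined : (r s n : ℕ) → List (Table n r × Table n s)
oddOverlined r s n =
  filterᵇ (λ { (l , v) → ((weight l + weight v) ≡ᵇ n) ∧ oddParts v })
    (pairs (allTables n r n) (allTables n s n))

F : (r s k n : ℕ) → ℕ
F r s k n = sum (map (λ { (l , m) → partsOfSize k l }) (overpartitions r s n))

G : (r s k n : ℕ) → ℕ
G r s k n = sum (map (λ { (l , m) → distinctAtLeast k l }) (overpartitions r s n))

Fd : (r s k n : ℕ) → ℕ
Fd r s k n = sum (map (λ { (l , m) → partsOfSize k m }) (overpartitions r s n))

Fo : (r s k n : ℕ) → ℕ
Fo r s k n = sum (map (λ { (l , v) → partsOfSize k v }) (oddOverlined r s n))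

Go : (r s k n : ℕ) → ℕ
Go r s k n = sum (map (λ { (l , v) → distinctAtLeast k v }) (oddOverlined r s n))

GoShift : (r s k n : ℕ) → ℕ
GoShift r s k n = if k <ᵇ n then Go r s k (n ∸ k) else 0

-- Each statistic is additive over the independent pieces of an object (the multiplicities of the
-- colored parts of each size), so, as for a logarithmic derivative, its generating function is the
-- counting series times a sum of densities, one for each part size.  Counting parts of size k gives
-- r q^k / (1 - q^k); counting colored parts of size j repeated at least k times gives r q^jk, which
-- sums over j to the same series: hence F = G.  Distinct parts of size k give s q^k / (1 + q^k), odd
-- parts repeated at least k times give s Σ_{j odd} q^jk = s q^k / (1 - q^2k), and Euler's identity
-- ∏ (1 + q^j)^s = ∏_{j odd} (1 - q^j)^-s identifies the two counting series, so the relations for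
-- Fd and Fo become identities between these rational functions.  All series are truncated at the
-- degree n that the finite enumerations can see.
module Submission where

open import Data.Bool using (Bool; true; false; if_then_else_; not; _∧_; _∨_)
open import Data.Bool.Properties using (∨-distribˡ-∧; ∨-zeroʳ; ∧-identityʳ)
open import Data.Empty using (⊥-elim)
open import Data.List using (List; []; _∷_; _++_; map; concatMap; filterᵇ; upTo; applyUpTo)
open import Data.List.Properties using (upTo-∷ʳ; map-upTo)
open import Data.Nat
  using (ℕ; zero; suc; _+_; _*_; _∸_; _≤_; _<_; z≤n; s≤s; _≤ᵇ_; _≡ᵇ_; _<ᵇ_; _≟_; _≤?_; _%_
        ; NonZero; >-nonZero; >-nonZero⁻¹; ≢-nonZero⁻¹)
open import Data.Nat.ListAction using (sum)
open import Data.Nat.Properties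
open import Algebra.Properties.CommutativeSemigroup +-commutativeSemigroup
  using () renaming (interchange to +-interchange; x∙yz≈y∙xz to x+[y+z]≡y+[x+z])
open import Data.Nat.Tactic.RingSolver using (solve-∀)
open import Data.Product using (_×_; _,_; proj₁; proj₂)
open import Data.Sum using (inj₁; inj₂)
open import Data.Unit using (tt)
open import Data.Vec using (Vec; []; _∷_)
open import Relation.Binary.Bundles using (Setoid)
open import Relation.Binary.PropositionalEquality
open import Relation.Nullary using (yes; no)
import Relation.Binary.Reasoning.Setoid as SetoidReasoning

open import Defs

-- Truncated power series

Series : Set
Series = ℕ → ℕ

infix 4 _≈[_]_
_≈[_]_ : Series → ℕ → Series → Set
f ≈[ n ] g = ∀ i → i ≤ n → f i ≡ g i

infixl 6 _⊞_
_⊞_ : Series → Series → Series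
(f ⊞ g) i = f i + g i

0ˢ : Series
0ˢ _ = 0

const : ℕ → Series
const a zero    = a
const a (suc _) = 0

1ˢ : Series
1ˢ = const 1

scale : ℕ → Series → Series
scale a f i = a * f i

tail : Series → Series
tail f i = f (suc i)

shift : ℕ → Series → Series
shift zero    f i       = f i
shift (suc a) f zero    = 0
shift (suc a) f (suc i) = shift a f i

infixl 7 _⊛_
_⊛_ : Series → Series → Series
(f ⊛ g) zero    = f 0 * g 0
(f ⊛ g) (suc n) = f 0 * g (suc n) + (tail f ⊛ g) n

≈-refl : ∀ {f n} → f ≈[ n ] f
≈-refl i _ = refl

≈-sym : ∀ {f g n} → f ≈[ n ] g → g ≈[ n ] f
≈-sym p i h = sym (p i h)

≈-trans : ∀ {f g h n} → f ≈[ n ] g → g ≈[ n ] h → f ≈[ n ] h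
≈-trans p q i h = trans (p i h) (q i h)

≈-setoid : ℕ → Setoid _ _
≈-setoid n = record
  { Carrier = Series
  ; _≈_ = _≈[ n ]_
  ; isEquivalence = record { refl = ≈-refl ; sym = ≈-sym ; trans = ≈-trans }
  }

module ≈-Reasoning (n : ℕ) = SetoidReasoning (≈-setoid n)

≗⇒≈ : ∀ {f g n} → f ≗ g → f ≈[ n ] g
≗⇒≈ p i _ = p i

≈-restrict : ∀ {f g n m} → m ≤ n → f ≈[ n ] g → f ≈[ m ] g
≈-restrict m≤n p i h = p i (≤-trans h m≤n)

⊞-cong : ∀ {f f′ g g′ n} → f ≈[ n ] f′ → g ≈[ n ] g′ → f ⊞ g ≈[ n ] f′ ⊞ g′
⊞-cong p q i h = cong₂ _+_ (p i h) (q i h)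

scale-cong : ∀ {f g n} a → f ≈[ n ] g → scale a f ≈[ n ] scale a g
scale-cong a p i h = cong (a *_) (p i h)

⊛-cong : ∀ {f f′ g g′ n} → f ≈[ n ] f′ → g ≈[ n ] g′ → f ⊛ g ≈[ n ] f′ ⊛ g′
⊛-cong {f} {f′} {g} {g′} p q zero    _ = cong₂ _*_ (p 0 z≤n) (q 0 z≤n)
⊛-cong {f} {f′} {g} {g′} p q (suc i) h =
  cong₂ _+_ (cong₂ _*_ (p 0 z≤n) (q (suc i) h))
            (⊛-cong {tail f} {tail f′} {g} {g′} {i} (λ j j≤i → p (suc j) (≤-trans (s≤s j≤i) h))
                    (λ j j≤i → q j (≤-trans j≤i (≤-trans (n≤1+n i) h))) i ≤-refl)

⊛-cong-≗ : ∀ {f f′ g g′} → f ≗ f′ → g ≗ g′ → f ⊛ g ≗ f′ ⊛ g′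
⊛-cong-≗ p q i = ⊛-cong (≗⇒≈ p) (≗⇒≈ q) i ≤-refl

⊛-zeroˡ : ∀ g → 0ˢ ⊛ g ≗ 0ˢ
⊛-zeroˡ g zero    = refl
⊛-zeroˡ g (suc i) = ⊛-zeroˡ g i

⊛-zeroʳ : ∀ f → f ⊛ 0ˢ ≗ 0ˢ
⊛-zeroʳ f zero = *-zeroʳ (f 0)
⊛-zeroʳ f (suc i) rewrite ⊛-zeroʳ (tail f) i | *-zeroʳ (f 0) = refl

⊛-distribʳ-⊞ : ∀ f g h → (f ⊞ g) ⊛ h ≗ f ⊛ h ⊞ g ⊛ h
⊛-distribʳ-⊞ f g h zero = *-distribʳ-+ (h 0) (f 0) (g 0)
⊛-distribʳ-⊞ f g h (suc i)
  rewrite ⊛-distribʳ-⊞ (tail f) (tail g) h i | *-distribʳ-+ (h (suc i)) (f 0) (g 0) =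
  +-interchange (f 0 * h (suc i)) (g 0 * h (suc i)) ((tail f ⊛ h) i) ((tail g ⊛ h) i)

⊛-distribˡ-⊞ : ∀ f g h → f ⊛ (g ⊞ h) ≗ f ⊛ g ⊞ f ⊛ h
⊛-distribˡ-⊞ f g h zero = *-distribˡ-+ (f 0) (g 0) (h 0)
⊛-distribˡ-⊞ f g h (suc i)
  rewrite ⊛-distribˡ-⊞ (tail f) g h i | *-distribˡ-+ (f 0) (g (suc i)) (h (suc i)) =
  +-interchange (f 0 * g (suc i)) (f 0 * h (suc i)) ((tail f ⊛ g) i) ((tail f ⊛ h) i)

⊛-scaleˡ : ∀ a f g → scale a f ⊛ g ≗ scale a (f ⊛ g)
⊛-scaleˡ a f g zero = *-assoc a (f 0) (g 0)
⊛-scaleˡ a f g (suc i) rewrite ⊛-scaleˡ a (tail f) g i | *-assoc a (f 0) (g (suc i)) =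
  sym (*-distribˡ-+ a (f 0 * g (suc i)) ((tail f ⊛ g) i))

⊛-constˡ : ∀ a g → const a ⊛ g ≗ scale a g
⊛-constˡ a g zero    = refl
⊛-constˡ a g (suc i) rewrite ⊛-zeroˡ g i = +-identityʳ _

⊛-identityˡ : ∀ g → 1ˢ ⊛ g ≗ g
⊛-identityˡ g i = trans (⊛-constˡ 1 g i) (*-identityˡ _)

⊛-shiftˡ : ∀ a f g → shift a f ⊛ g ≗ shift a (f ⊛ g)
⊛-shiftˡ zero    f g i       = refl
⊛-shiftˡ (suc a) f g zero    = refl
⊛-shiftˡ (suc a) f g (suc i) = ⊛-shiftˡ a f g i

⊛-comm : ∀ f g → f ⊛ g ≗ g ⊛ f
⊛-comm f g zero = *-comm (f 0) (g 0)
⊛-comm f g (suc zero)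
  rewrite *-comm (f 0) (g 1) | *-comm (f 1) (g 0) = +-comm (g 1 * f 0) (g 0 * f 1)
⊛-comm f g (suc (suc i)) = begin
  f 0 * g (2 + i) + (tail f ⊛ g) (suc i)
    ≡⟨ cong ((f 0 * g (2 + i)) +_) (⊛-comm (tail f) g (suc i)) ⟩
  f 0 * g (2 + i) + (g 0 * f (2 + i) + (tail g ⊛ tail f) i)
    ≡⟨ cong (λ z → f 0 * g (2 + i) + (g 0 * f (2 + i) + z)) (⊛-comm (tail g) (tail f) i) ⟩
  f 0 * g (2 + i) + (g 0 * f (2 + i) + (tail f ⊛ tail g) i)
    ≡⟨ x+[y+z]≡y+[x+z] (f 0 * g (2 + i)) (g 0 * f (2 + i)) ((tail f ⊛ tail g) i) ⟩
  g 0 * f (2 + i) + (f 0 * g (2 + i) + (tail f ⊛ tail g) i)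
    ≡⟨ cong ((g 0 * f (2 + i)) +_) (⊛-comm (tail g) f (suc i)) ⟨
  g 0 * f (2 + i) + (tail g ⊛ f) (suc i)
    ∎
  where open ≡-Reasoning

⊛-assoc : ∀ f g h → (f ⊛ g) ⊛ h ≗ f ⊛ (g ⊛ h)
⊛-assoc f g h zero = *-assoc (f 0) (g 0) (h 0)
⊛-assoc f g h (suc i) = begin
  f 0 * g 0 * h (suc i) + (tail (f ⊛ g) ⊛ h) i
    ≡⟨ cong ((f 0 * g 0 * h (suc i)) +_) (⊛-distribʳ-⊞ (scale (f 0) (tail g)) (tail f ⊛ g) h i) ⟩
  f 0 * g 0 * h (suc i) + ((scale (f 0) (tail g) ⊛ h) i + ((tail f ⊛ g) ⊛ h) i)
    ≡⟨ cong₂ (λ a b → f 0 * g 0 * h (suc i) + (a + b)) (⊛-scaleˡ (f 0) (tail g) h i) (⊛-assoc (tail f) g h i) ⟩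
  f 0 * g 0 * h (suc i) + (f 0 * (tail g ⊛ h) i + (tail f ⊛ (g ⊛ h)) i)
    ≡⟨ regroup (f 0) (g 0) (h (suc i)) ((tail g ⊛ h) i) ((tail f ⊛ (g ⊛ h)) i) ⟩
  f 0 * (g 0 * h (suc i) + (tail g ⊛ h) i) + (tail f ⊛ (g ⊛ h)) i
    ∎
  where
  open ≡-Reasoning
  regroup : ∀ a b c d e → a * b * c + (a * d + e) ≡ a * (b * c + d) + e
  regroup = solve-∀

⊛-rotate : ∀ f g h → f ⊛ (g ⊛ h) ≗ g ⊛ (f ⊛ h)
⊛-rotate f g h i = begin
  (f ⊛ (g ⊛ h)) i  ≡⟨ ⊛-assoc f g h i ⟨
  ((f ⊛ g) ⊛ h) i  ≡⟨ ⊛-cong-≗ (⊛-comm f g) (λ _ → refl) i ⟩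
  ((g ⊛ f) ⊛ h) i  ≡⟨ ⊛-assoc g f h i ⟩
  (g ⊛ (f ⊛ h)) i  ∎
  where open ≡-Reasoning

⊛-interchange : ∀ a b c d → (a ⊛ b) ⊛ (c ⊛ d) ≗ (a ⊛ c) ⊛ (b ⊛ d)
⊛-interchange a b c d i = begin
  ((a ⊛ b) ⊛ (c ⊛ d)) i  ≡⟨ ⊛-assoc a b (c ⊛ d) i ⟩
  (a ⊛ (b ⊛ (c ⊛ d))) i  ≡⟨ ⊛-cong-≗ (λ _ → refl) (⊛-rotate b c d) i ⟩
  (a ⊛ (c ⊛ (b ⊛ d))) i  ≡⟨ ⊛-assoc a c (b ⊛ d) i ⟨
  ((a ⊛ c) ⊛ (b ⊛ d)) i  ∎
  where open ≡-Reasoning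

shift-≗ : ∀ a {f g} → f ≗ g → shift a f ≗ shift a g
shift-≗ zero    p i       = p i
shift-≗ (suc a) p zero    = refl
shift-≗ (suc a) p (suc i) = shift-≗ a p i

shift-⊞ : ∀ a f g → shift a (f ⊞ g) ≗ shift a f ⊞ shift a g
shift-⊞ zero    f g i       = refl
shift-⊞ (suc a) f g zero    = refl
shift-⊞ (suc a) f g (suc i) = shift-⊞ a f g i

shift-scale : ∀ a c f → shift a (scale c f) ≗ scale c (shift a f)
shift-scale zero    c f i       = refl
shift-scale (suc a) c f zero    = sym (*-zeroʳ c)
shift-scale (suc a) c f (suc i) = shift-scale a c f i

shift-0ˢ : ∀ a → shift a 0ˢ ≗ 0ˢ
shift-0ˢ zero    i       = refl
shift-0ˢ (suc a) zero    = refl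
shift-0ˢ (suc a) (suc i) = shift-0ˢ a i

shift-+ : ∀ a b f → shift a (shift b f) ≗ shift (a + b) f
shift-+ zero    b f i       = refl
shift-+ (suc a) b f zero    = refl
shift-+ (suc a) b f (suc i) = shift-+ a b f i

shift-comm : ∀ a b f → shift a (shift b f) ≗ shift b (shift a f)
shift-comm a b f i = begin
  shift a (shift b f) i  ≡⟨ shift-+ a b f i ⟩
  shift (a + b) f i      ≡⟨ cong (λ c → shift c f i) (+-comm a b) ⟩
  shift (b + a) f i      ≡⟨ shift-+ b a f i ⟨
  shift b (shift a f) i  ∎
  where open ≡-Reasoning

⊛-shiftʳ : ∀ a f g → f ⊛ shift a g ≗ shift a (f ⊛ g)
⊛-shiftʳ a f g i = begin
  (f ⊛ shift a g) i    ≡⟨ ⊛-comm f (shift a g) i ⟩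
  (shift a g ⊛ f) i    ≡⟨ ⊛-shiftˡ a g f i ⟩
  shift a (g ⊛ f) i    ≡⟨ shift-≗ a (⊛-comm g f) i ⟩
  shift a (f ⊛ g) i    ∎
  where open ≡-Reasoning

shift-1ˢ-⊛ : ∀ a f → shift a 1ˢ ⊛ f ≗ shift a f
shift-1ˢ-⊛ a f i = trans (⊛-shiftˡ a 1ˢ f i) (shift-≗ a (⊛-identityˡ f) i)

shift-const : ∀ a c → shift a (const c) ≗ λ d → if a ≡ᵇ d then c else 0
shift-const zero    c zero    = refl
shift-const zero    c (suc d) = refl
shift-const (suc a) c zero    = refl
shift-const (suc a) c (suc d) = shift-const a c d

shift-vanishes : ∀ a f {n} → n < a → shift a f ≈[ n ] 0ˢ
shift-vanishes (suc a) f         _       zero    _         = refl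
shift-vanishes (suc a) f {suc n} (s≤s h) (suc i) (s≤s i≤n) = shift-vanishes a f h i i≤n

shift-below : ∀ a f {n} → n < a → shift a f n ≡ 0
shift-below a f h = shift-vanishes a f h _ ≤-refl

shift-apply : ∀ a f {n} → a ≤ n → shift a f n ≡ f (n ∸ a)
shift-apply zero    f         _       = refl
shift-apply (suc a) f {suc n} (s≤s h) = shift-apply a f h

shift-cong-∸ : ∀ a {f g n} → f ≈[ n ∸ a ] g → shift a f ≈[ n ] shift a g
shift-cong-∸ zero    p i       h       = p i h
shift-cong-∸ (suc a) p zero    h       = refl
shift-cong-∸ (suc a) {n = suc n} p (suc i) (s≤s h) = shift-cong-∸ a {n = n} p i h

shift-cong : ∀ a {f g n} → f ≈[ n ] g → shift a f ≈[ n ] shift a g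
shift-cong a {n = n} p = shift-cong-∸ a (≈-restrict (m∸n≤m n a) p)

shift-fixpoint-unique : ∀ a .{{_ : NonZero a}} {U V H n} →
  U ≈[ n ] H ⊞ shift a U → V ≈[ n ] H ⊞ shift a V → U ≈[ n ] V
shift-fixpoint-unique a {U} {V} {H} {n} pU pV = go n ≤-refl
  where
  step : ∀ i → i ≤ n → shift a U i ≡ shift a V i → U i ≡ V i
  step i i≤n e = trans (pU i i≤n) (trans (cong (H i +_) e) (sym (pV i i≤n)))
  go : ∀ m → m ≤ n → U ≈[ m ] V
  go zero    m≤n zero _ =
    step 0 z≤n (trans (shift-below a U (>-nonZero⁻¹ a)) (sym (shift-below a V (>-nonZero⁻¹ a))))
  go (suc m) m≤n i i≤m with m≤n⇒m<n∨m≡n i≤m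
  ... | inj₁ (s≤s i≤m′) = go m (<⇒≤ m≤n) i i≤m′
  ... | inj₂ refl = step (suc m) m≤n
    (shift-cong-∸ a (≈-restrict (∸-monoʳ-≤ (suc m) (>-nonZero⁻¹ a)) (go m (<⇒≤ m≤n))) (suc m) ≤-refl)

⊛-cancelˡ : ∀ {P U V n} → P 0 ≡ 1 → P ⊛ U ≈[ n ] P ⊛ V → U ≈[ n ] V
⊛-cancelˡ {P} {U} {V} {n} P0≡1 PU≈PV = go n ≤-refl
  where
  unit : ∀ {x y} → P 0 * x ≡ P 0 * y → x ≡ y
  unit {x} {y} e = *-cancelˡ-≡ x y (P 0) {{subst NonZero (sym P0≡1) _}} e
  go : ∀ m → m ≤ n → U ≈[ m ] V
  go zero    m≤n zero _ = unit (PU≈PV 0 z≤n)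
  go (suc m) m≤n i i≤m with m≤n⇒m<n∨m≡n i≤m
  ... | inj₁ (s≤s i≤m′) = go m (<⇒≤ m≤n) i i≤m′
  ... | inj₂ refl = unit (+-cancelʳ-≡ _ _ _ (trans (PU≈PV (suc m) m≤n) (cong (P 0 * V (suc m) +_) tails)))
    where
    tails : (tail P ⊛ V) m ≡ (tail P ⊛ U) m
    tails = ⊛-cong {tail P} ≈-refl (≈-sym (go m (<⇒≤ m≤n))) m ≤-refl

-- Generating functions of lists

monomial : ℕ → ℕ → Series
monomial c v d = if c ≡ᵇ d then v else 0

monomial-⊛ : ∀ c v g → monomial c v ⊛ g ≗ scale v (shift c g)
monomial-⊛ c v g i = begin
  (monomial c v ⊛ g) i         ≡⟨ ⊛-cong-≗ (λ d → sym (shift-const c v d)) (λ _ → refl) i ⟩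
  (shift c (const v) ⊛ g) i    ≡⟨ ⊛-shiftˡ c (const v) g i ⟩
  shift c (const v ⊛ g) i      ≡⟨ shift-≗ c (⊛-constˡ v g) i ⟩
  shift c (scale v g) i        ≡⟨ shift-scale c v g i ⟩
  scale v (shift c g) i        ∎
  where open ≡-Reasoning

monomial-shift : ∀ c x a v → monomial (c + x) (a * v) ≗ scale a (shift c (monomial x v))
monomial-shift zero    x a v d       with x ≡ᵇ d
... | true  = refl
... | false = sym (*-zeroʳ a)
monomial-shift (suc c) x a v zero    = sym (*-zeroʳ a)
monomial-shift (suc c) x a v (suc d) = monomial-shift c x a v d

module _ {A : Set} where

  gf : List A → (A → ℕ) → (A → ℕ) → Series
  gf []      w g = 0ˢ
  gf (a ∷ L) w g = monomial (w a) (g a) ⊞ gf L w g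

  gf-++ : ∀ L L′ w g → gf (L ++ L′) w g ≗ gf L w g ⊞ gf L′ w g
  gf-++ []      L′ w g d = refl
  gf-++ (a ∷ L) L′ w g d rewrite gf-++ L L′ w g d = sym (+-assoc (monomial (w a) (g a) d) _ _)

  gf-≗ : ∀ L {w w′ g g′} → w ≗ w′ → g ≗ g′ → gf L w g ≗ gf L w′ g′
  gf-≗ []      pw pg d = refl
  gf-≗ (a ∷ L) pw pg d rewrite pw a | pg a | gf-≗ L pw pg d = refl

  gf-⊞ : ∀ L w g h → gf L w (λ a → g a + h a) ≗ gf L w g ⊞ gf L w h
  gf-⊞ []      w g h d = refl
  gf-⊞ (a ∷ L) w g h d rewrite gf-⊞ L w g h d with w a ≡ᵇ d
  ... | true  = +-interchange (g a) (h a) (gf L w g d) (gf L w h d)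
  ... | false = refl

  gf-zero : ∀ L w → gf L w (λ _ → 0) ≗ 0ˢ
  gf-zero []      w d = refl
  gf-zero (a ∷ L) w d rewrite gf-zero L w d with w a ≡ᵇ d
  ... | true  = refl
  ... | false = refl

  gf-shift : ∀ L c a w h → gf L (λ b → c + w b) (λ b → a * h b) ≗ scale a (shift c (gf L w h))
  gf-shift []      c a w h d = sym (trans (cong (a *_) (shift-0ˢ c d)) (*-zeroʳ a))
  gf-shift (b ∷ L) c a w h d = begin
    monomial (c + w b) (a * h b) d + gf L _ _ d
      ≡⟨ cong₂ _+_ (monomial-shift c (w b) a (h b) d) (gf-shift L c a w h d) ⟩
    a * shift c (monomial (w b) (h b)) d + a * shift c (gf L w h) d
      ≡⟨ *-distribˡ-+ a _ _ ⟨
    a * (shift c (monomial (w b) (h b)) d + shift c (gf L w h) d)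
      ≡⟨ cong (a *_) (shift-⊞ c (monomial (w b) (h b)) (gf L w h) d) ⟨
    a * shift c (gf (b ∷ L) w h) d
      ∎
    where open ≡-Reasoning

  sum-filter≡gf : ∀ L p g w g′ n → (∀ a → (if p a then g a else 0) ≡ monomial (w a) (g′ a) n) →
                  sum (map g (filterᵇ p L)) ≡ gf L w g′ n
  sum-filter≡gf []      p g w g′ n h = refl
  sum-filter≡gf (a ∷ L) p g w g′ n h with p a | h a
  ... | true  | e = cong₂ _+_ e (sum-filter≡gf L p g w g′ n h)
  ... | false | e = cong₂ _+_ e (sum-filter≡gf L p g w g′ n h)

const-0 : const 0 ≗ 0ˢ
const-0 zero    = refl
const-0 (suc _) = refl

monomial-zero : ∀ v → monomial 0 v ≗ const v
monomial-zero v zero    = refl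
monomial-zero v (suc d) = refl

monomial-below : ∀ c v {d} → d < c → monomial c v d ≡ 0
monomial-below c v {d} d<c = trans (sym (shift-const c v d)) (shift-below c (const v) d<c)

monomial-0 : ∀ c → monomial c 0 ≗ 0ˢ
monomial-0 c d with c ≡ᵇ d
... | true  = refl
... | false = refl

gf-map : ∀ {A B : Set} (f : A → B) L w g → gf (map f L) w g ≗ gf L (λ a → w (f a)) (λ a → g (f a))
gf-map f []      w g d = refl
gf-map f (a ∷ L) w g d = cong (monomial (w (f a)) (g (f a)) d +_) (gf-map f L w g d)

module _ {A B X : Set} (f : A → B → X) (L₁ : List A) (L₂ : List B) where

  gf-product₂ : ∀ wX hX w₁ h₁ k₁ w₂ h₂ k₂ →
    (∀ a b → wX (f a b) ≡ w₁ a + w₂ b) → (∀ a b → hX (f a b) ≡ h₁ a * h₂ b + k₁ a * k₂ b) →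
    gf (concatMap (λ a → map (f a) L₂) L₁) wX hX
      ≗ gf L₁ w₁ h₁ ⊛ gf L₂ w₂ h₂ ⊞ gf L₁ w₁ k₁ ⊛ gf L₂ w₂ k₂
  gf-product₂ wX hX w₁ h₁ k₁ w₂ h₂ k₂ pw ph = go L₁
    where
    H₂ = gf L₂ w₂ h₂
    K₂ = gf L₂ w₂ k₂
    go : ∀ L → gf (concatMap (λ a → map (f a) L₂) L) wX hX ≗ gf L w₁ h₁ ⊛ H₂ ⊞ gf L w₁ k₁ ⊛ K₂
    go []      d = sym (cong₂ _+_ (⊛-zeroˡ H₂ d) (⊛-zeroˡ K₂ d))
    go (a ∷ L) d = begin
      gf (map (f a) L₂ ++ rest) wX hX d
        ≡⟨ gf-++ (map (f a) L₂) rest wX hX d ⟩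
      gf (map (f a) L₂) wX hX d + gf rest wX hX d
        ≡⟨ cong₂ _+_ row (go L d) ⟩
      (mₕ ⊛ H₂) d + (mₖ ⊛ K₂) d + ((gf L w₁ h₁ ⊛ H₂) d + (gf L w₁ k₁ ⊛ K₂) d)
        ≡⟨ +-interchange ((mₕ ⊛ H₂) d) _ _ _ ⟩
      (mₕ ⊛ H₂) d + (gf L w₁ h₁ ⊛ H₂) d + ((mₖ ⊛ K₂) d + (gf L w₁ k₁ ⊛ K₂) d)
        ≡⟨ cong₂ _+_ (⊛-distribʳ-⊞ mₕ (gf L w₁ h₁) H₂ d) (⊛-distribʳ-⊞ mₖ (gf L w₁ k₁) K₂ d) ⟨
      (gf (a ∷ L) w₁ h₁ ⊛ H₂) d + (gf (a ∷ L) w₁ k₁ ⊛ K₂) d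
        ∎
      where
      open ≡-Reasoning
      rest = concatMap (λ a → map (f a) L₂) L
      mₕ = monomial (w₁ a) (h₁ a)
      mₖ = monomial (w₁ a) (k₁ a)
      row : gf (map (f a) L₂) wX hX d ≡ (mₕ ⊛ H₂) d + (mₖ ⊛ K₂) d
      row = begin
        gf (map (f a) L₂) wX hX d
          ≡⟨ trans (gf-map (f a) L₂ wX hX d) (gf-≗ L₂ (pw a) (ph a) d) ⟩
        gf L₂ (λ b → w₁ a + w₂ b) (λ b → h₁ a * h₂ b + k₁ a * k₂ b) d
          ≡⟨ gf-⊞ L₂ _ (λ b → h₁ a * h₂ b) (λ b → k₁ a * k₂ b) d ⟩
        gf L₂ (λ b → w₁ a + w₂ b) (λ b → h₁ a * h₂ b) d + gf L₂ (λ b → w₁ a + w₂ b) (λ b → k₁ a * k₂ b) d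
          ≡⟨ cong₂ _+_ (gf-shift L₂ (w₁ a) (h₁ a) w₂ h₂ d) (gf-shift L₂ (w₁ a) (k₁ a) w₂ k₂ d) ⟩
        h₁ a * shift (w₁ a) H₂ d + k₁ a * shift (w₁ a) K₂ d
          ≡⟨ cong₂ _+_ (monomial-⊛ (w₁ a) (h₁ a) H₂ d) (monomial-⊛ (w₁ a) (k₁ a) K₂ d) ⟨
        (mₕ ⊛ H₂) d + (mₖ ⊛ K₂) d
          ∎

  gf-product : ∀ wX hX w₁ h₁ w₂ h₂ →
    (∀ a b → wX (f a b) ≡ w₁ a + w₂ b) → (∀ a b → hX (f a b) ≡ h₁ a * h₂ b) →
    gf (concatMap (λ a → map (f a) L₂) L₁) wX hX ≗ gf L₁ w₁ h₁ ⊛ gf L₂ w₂ h₂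
  gf-product wX hX w₁ h₁ w₂ h₂ pw ph d = begin
    gf (concatMap (λ a → map (f a) L₂) L₁) wX hX d
      ≡⟨ gf-product₂ wX hX w₁ h₁ (λ _ → 0) w₂ h₂ h₂ pw (λ a b → trans (ph a b) (sym (+-identityʳ _))) d ⟩
    (gf L₁ w₁ h₁ ⊛ H₂) d + (gf L₁ w₁ (λ _ → 0) ⊛ H₂) d
      ≡⟨ cong ((gf L₁ w₁ h₁ ⊛ H₂) d +_) (trans (⊛-cong-≗ (gf-zero L₁ w₁) (λ _ → refl) d)
                                               (⊛-zeroˡ H₂ d)) ⟩
    (gf L₁ w₁ h₁ ⊛ H₂) d + 0
      ≡⟨ +-identityʳ _ ⟩
    (gf L₁ w₁ h₁ ⊛ H₂) d
      ∎
    where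
    open ≡-Reasoning
    H₂ = gf L₂ w₂ h₂

boolToℕ : Bool → ℕ
boolToℕ b = if b then 1 else 0

guarded : Bool → ℕ → ℕ
guarded b x = if b then x else 0

boolToℕ-∧ : ∀ a b → boolToℕ (a ∧ b) ≡ boolToℕ a * boolToℕ b
boolToℕ-∧ true  b = sym (*-identityˡ _)
boolToℕ-∧ false b = refl

guarded-∧-+ : ∀ a b p q → guarded (a ∧ b) (p + q) ≡ guarded a p * boolToℕ b + boolToℕ a * guarded b q
guarded-∧-+ true  true  p q = cong₂ _+_ (sym (*-identityʳ p)) (sym (*-identityˡ q))
guarded-∧-+ true  false p q = sym (trans (+-identityʳ _) (*-zeroʳ p))
guarded-∧-+ false b     p q = refl

guarded-+ : ∀ b x y → guarded b (x + y) ≡ guarded b x + guarded b y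
guarded-+ true  x y = refl
guarded-+ false x y = refl

guarded-0 : ∀ b → guarded b 0 ≡ 0
guarded-0 true  = refl
guarded-0 false = refl

-- Densities

-- HasDensity P n Ψ C G: G = (Ψ / P) ⊛ C up to degree n, with the denominator cleared.
HasDensity : Series → ℕ → Series → Series → Series → Set
HasDensity P n Ψ C G = P ⊛ G ≈[ n ] Ψ ⊛ C

density-zero : ∀ {P n C G} → G ≗ 0ˢ → HasDensity P n 0ˢ C G
density-zero {P} {n} {C} {G} G≗0 = ≗⇒≈ λ i → begin
  (P ⊛ G) i   ≡⟨ ⊛-cong-≗ (λ _ → refl) G≗0 i ⟩
  (P ⊛ 0ˢ) i  ≡⟨ ⊛-zeroʳ P i ⟩
  0           ≡⟨ ⊛-zeroˡ C i ⟨
  (0ˢ ⊛ C) i  ∎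
  where open ≡-Reasoning

density-cong : ∀ {P n Ψ Ψ′ C C′ G G′} → Ψ ≈[ n ] Ψ′ → C ≗ C′ → G ≗ G′ →
               HasDensity P n Ψ C G → HasDensity P n Ψ′ C′ G′
density-cong {P} {n} {Ψ} {Ψ′} {C} {C′} {G} {G′} Ψ≈Ψ′ C≗C′ G≗G′ PG≈ΨC = begin
  P ⊛ G′  ≈⟨ ⊛-cong {P} ≈-refl (≗⇒≈ G≗G′) ⟨
  P ⊛ G   ≈⟨ PG≈ΨC ⟩
  Ψ ⊛ C   ≈⟨ ⊛-cong Ψ≈Ψ′ (≗⇒≈ C≗C′) ⟩
  Ψ′ ⊛ C′ ∎
  where open ≈-Reasoning n

density-⊛ : ∀ {P n Ψ₁ C₁ G₁ Ψ₂ C₂ G₂} → HasDensity P n Ψ₁ C₁ G₁ → HasDensity P n Ψ₂ C₂ G₂ →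
            HasDensity P n (Ψ₁ ⊞ Ψ₂) (C₁ ⊛ C₂) (G₁ ⊛ C₂ ⊞ C₁ ⊛ G₂)
density-⊛ {P} {n} {Ψ₁} {C₁} {G₁} {Ψ₂} {C₂} {G₂} h₁ h₂ = begin
  P ⊛ (G₁ ⊛ C₂ ⊞ C₁ ⊛ G₂)
    ≈⟨ ≗⇒≈ (⊛-distribˡ-⊞ P (G₁ ⊛ C₂) (C₁ ⊛ G₂)) ⟩
  P ⊛ (G₁ ⊛ C₂) ⊞ P ⊛ (C₁ ⊛ G₂)
    ≈⟨ ≗⇒≈ (λ i → cong₂ _+_ (sym (⊛-assoc P G₁ C₂ i)) (⊛-rotate P C₁ G₂ i)) ⟩
  (P ⊛ G₁) ⊛ C₂ ⊞ C₁ ⊛ (P ⊛ G₂)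
    ≈⟨ ⊞-cong (⊛-cong h₁ ≈-refl) (⊛-cong {C₁} ≈-refl h₂) ⟩
  (Ψ₁ ⊛ C₁) ⊛ C₂ ⊞ C₁ ⊛ (Ψ₂ ⊛ C₂)
    ≈⟨ ≗⇒≈ (λ i → cong₂ _+_ (⊛-assoc Ψ₁ C₁ C₂ i) (⊛-rotate C₁ Ψ₂ C₂ i)) ⟩
  Ψ₁ ⊛ (C₁ ⊛ C₂) ⊞ Ψ₂ ⊛ (C₁ ⊛ C₂)
    ≈⟨ ≗⇒≈ (⊛-distribʳ-⊞ Ψ₁ Ψ₂ (C₁ ⊛ C₂)) ⟨
  (Ψ₁ ⊞ Ψ₂) ⊛ (C₁ ⊛ C₂)
    ∎
  where open ≈-Reasoning n

module _ {A B X : Set} (f : A → B → X) (L₁ : List A) (L₂ : List B)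
         (wX cX gX : X → ℕ) (w₁ c₁ g₁ : A → ℕ) (w₂ c₂ g₂ : B → ℕ)
         (wX-f : ∀ a b → wX (f a b) ≡ w₁ a + w₂ b)
         (cX-f : ∀ a b → cX (f a b) ≡ c₁ a * c₂ b)
         (gX-f : ∀ a b → gX (f a b) ≡ g₁ a * c₂ b + c₁ a * g₂ b) where

  private
    L = concatMap (λ a → map (f a) L₂) L₁

  gf-density-product : ∀ {P n Ψ₁ Ψ₂} → HasDensity P n Ψ₁ (gf L₁ w₁ c₁) (gf L₁ w₁ g₁) →
    HasDensity P n Ψ₂ (gf L₂ w₂ c₂) (gf L₂ w₂ g₂) → HasDensity P n (Ψ₁ ⊞ Ψ₂) (gf L wX cX) (gf L wX gX)
  gf-density-product h₁ h₂ =
    density-cong ≈-refl (λ i → sym (gf-product f L₁ L₂ wX cX w₁ c₁ w₂ c₂ wX-f cX-f i))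
      (λ i → sym (gf-product₂ f L₁ L₂ wX gX w₁ g₁ c₁ w₂ c₂ g₂ wX-f gX-f i)) (density-⊛ h₁ h₂)

density-1ˢ : ∀ {n Ψ C G} → HasDensity 1ˢ n Ψ C G → G ≈[ n ] Ψ ⊛ C
density-1ˢ {G = G} h = ≈-trans (≗⇒≈ (λ i → sym (⊛-identityˡ G i))) h

-- The multiplicity of one colored part

partGF : ℕ → ℕ → (ℕ → ℕ) → Series
partGF j b φ = gf (upTo (suc b)) (j *_) φ

partGF-extend : ∀ j b φ → partGF j (suc b) φ ≗ partGF j b φ ⊞ monomial (j * suc b) (φ (suc b))
partGF-extend j b φ d = begin
  gf (upTo (suc (suc b))) (j *_) φ d                 ≡⟨ cong (λ L → gf L (j *_) φ d) (sym (upTo-∷ʳ (suc b))) ⟩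
  gf (upTo (suc b) ++ suc b ∷ []) (j *_) φ d         ≡⟨ gf-++ (upTo (suc b)) (suc b ∷ []) (j *_) φ d ⟩
  partGF j b φ d + (monomial (j * suc b) (φ (suc b)) d + 0)
                                                      ≡⟨ cong (partGF j b φ d +_) (+-identityʳ _) ⟩
  partGF j b φ d + monomial (j * suc b) (φ (suc b)) d ∎
  where open ≡-Reasoning

partGF-suc : ∀ j b φ → partGF j (suc b) φ ≗ const (φ 0) ⊞ shift j (partGF j b (λ x → φ (suc x)))
partGF-suc j b φ d = cong₂ _+_ head tail-shift
  where
  open ≡-Reasoning
  head : monomial (j * 0) (φ 0) d ≡ const (φ 0) d
  head = trans (cong (λ c → monomial c (φ 0) d) (*-zeroʳ j)) (monomial-zero (φ 0) d)
  tail-shift : gf (applyUpTo suc (suc b)) (j *_) φ d ≡ shift j (partGF j b (λ x → φ (suc x))) d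
  tail-shift = begin
    gf (applyUpTo suc (suc b)) (j *_) φ d
      ≡⟨ cong (λ L → gf L (j *_) φ d) (sym (map-upTo suc (suc b))) ⟩
    gf (map suc (upTo (suc b))) (j *_) φ d
      ≡⟨ gf-map suc (upTo (suc b)) (j *_) φ d ⟩
    gf (upTo (suc b)) (λ x → j * suc x) (λ x → φ (suc x)) d
      ≡⟨ gf-≗ (upTo (suc b)) (*-suc j) (λ x → sym (*-identityˡ (φ (suc x)))) d ⟩
    gf (upTo (suc b)) (λ x → j + j * x) (λ x → 1 * φ (suc x)) d
      ≡⟨ gf-shift (upTo (suc b)) j 1 (j *_) (λ x → φ (suc x)) d ⟩
    1 * shift j (partGF j b (λ x → φ (suc x))) d
      ≡⟨ *-identityˡ _ ⟩
    shift j (partGF j b (λ x → φ (suc x))) d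
      ∎

geometric : ℕ → ℕ → Series
geometric j b = partGF j b (λ _ → 1)

atLeast : ℕ → ℕ → ℕ
atLeast k x = if k ≤ᵇ x then 1 else 0

atLeast-0 : ∀ k .{{_ : NonZero k}} → atLeast k 0 ≡ 0
atLeast-0 zero    = ⊥-elim (≢-nonZero⁻¹ zero refl)
atLeast-0 (suc k) = refl

-- Multiplicities are bounded by b, so partGF j b agrees with the untruncated series only below
-- degree j (b + 1); the closed forms below therefore hold up to degrees n ≤ b.
module _ (j : ℕ) .{{_ : NonZero j}} {n b : ℕ} (n≤b : n ≤ b) where

  partGF-unfold : ∀ φ → partGF j b φ ≈[ n ] const (φ 0) ⊞ shift j (partGF j b (λ x → φ (suc x)))
  partGF-unfold φ i i≤n = begin
    partGF j b φ i                    ≡⟨ +-identityʳ _ ⟨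
    partGF j b φ i + 0                ≡⟨ cong (partGF j b φ i +_) (monomial-below (j * suc b) (φ (suc b)) i<jb) ⟨
    partGF j b φ i + monomial (j * suc b) (φ (suc b)) i
                                      ≡⟨ partGF-extend j b φ i ⟨
    partGF j (suc b) φ i              ≡⟨ partGF-suc j b φ i ⟩
    const (φ 0) i + shift j (partGF j b (λ x → φ (suc x))) i
                                      ∎
    where
    open ≡-Reasoning
    i<jb : i < j * suc b
    i<jb = ≤-trans (s≤s (≤-trans i≤n n≤b)) (m≤n*m (suc b) j)

  partGF-at-0 : ∀ φ → partGF j b φ 0 ≡ φ 0
  partGF-at-0 φ = begin
    partGF j b φ 0                                     ≡⟨ partGF-unfold φ 0 z≤n ⟩
    φ 0 + shift j (partGF j b (λ x → φ (suc x))) 0     ≡⟨ cong (φ 0 +_) (shift-below j _ (>-nonZero⁻¹ j)) ⟩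
    φ 0 + 0                                            ≡⟨ +-identityʳ (φ 0) ⟩
    φ 0                                                ∎
    where open ≡-Reasoning

  geometric-rec : geometric j b ≈[ n ] 1ˢ ⊞ shift j (geometric j b)
  geometric-rec = partGF-unfold (λ _ → 1)

  partGF-id-rec : partGF j b (λ x → x) ≈[ n ] shift j (geometric j b ⊞ partGF j b (λ x → x))
  partGF-id-rec = ≈-trans (partGF-unfold (λ x → x))
    (≗⇒≈ λ i → cong₂ _+_ (const-0 i) (shift-≗ j (gf-⊞ (upTo (suc b)) (j *_) (λ _ → 1) (λ x → x)) i))

  partGF-atLeast : ∀ k → partGF j b (atLeast k) ≈[ n ] shift (j * k) (geometric j b)
  partGF-atLeast zero    = ≗⇒≈ λ i → cong (λ c → shift c (geometric j b) i) (sym (*-zeroʳ j))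
  partGF-atLeast (suc k) = begin
    partGF j b (atLeast (suc k))
      ≈⟨ partGF-unfold (atLeast (suc k)) ⟩
    const 0 ⊞ shift j (partGF j b (λ x → atLeast (suc k) (suc x)))
      ≈⟨ ⊞-cong (≗⇒≈ const-0) (≗⇒≈ (shift-≗ j (gf-≗ (upTo (suc b)) (λ _ → refl) (atLeast-suc k)))) ⟩
    0ˢ ⊞ shift j (partGF j b (atLeast k))
      ≈⟨ ⊞-cong ≈-refl (shift-cong j (partGF-atLeast k)) ⟩
    0ˢ ⊞ shift j (shift (j * k) (geometric j b))
      ≈⟨ ≗⇒≈ (λ i → trans (shift-+ j (j * k) _ i) (cong (λ c → shift c (geometric j b) i) (sym (*-suc j k)))) ⟩
    shift (j * suc k) (geometric j b)
      ∎
    where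
    open ≈-Reasoning n
    atLeast-suc : ∀ k x → atLeast (suc k) (suc x) ≡ atLeast k x
    atLeast-suc zero    x = refl
    atLeast-suc (suc k) x = refl

partGF-bound-0 : ∀ j φ → partGF j 0 φ ≗ const (φ 0)
partGF-bound-0 j φ d =
  trans (+-identityʳ _) (trans (cong (λ c → monomial c (φ 0) d) (*-zeroʳ j)) (monomial-zero (φ 0) d))

partGF-bound-1 : ∀ j φ → partGF j 1 φ ≗ const (φ 0) ⊞ shift j (const (φ 1))
partGF-bound-1 j φ d =
  trans (partGF-suc j 0 φ d) (cong (const (φ 0) d +_) (shift-≗ j (partGF-bound-0 j (λ x → φ (suc x))) d))

partGF-only-zero : ∀ j b → partGF j b (λ x → if x ≡ᵇ 0 then 1 else 0) ≗ 1ˢ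
partGF-only-zero j zero    d = partGF-bound-0 j (λ x → if x ≡ᵇ 0 then 1 else 0) d
partGF-only-zero j (suc b) d = begin
  partGF j (suc b) _ d
    ≡⟨ partGF-suc j b _ d ⟩
  1ˢ d + shift j (partGF j b (λ _ → 0)) d
    ≡⟨ cong (1ˢ d +_) (trans (shift-≗ j (gf-zero (upTo (suc b)) (j *_)) d) (shift-0ˢ j d)) ⟩
  1ˢ d + 0
    ≡⟨ +-identityʳ _ ⟩
  1ˢ d
    ∎
  where open ≡-Reasoning

geometric-trivial : ∀ j .{{_ : NonZero j}} {m b} → m ≤ b → m < j → geometric j b ≈[ m ] 1ˢ
geometric-trivial j m≤b n<j =
  ≈-trans (geometric-rec j m≤b) (≈-trans (⊞-cong ≈-refl (shift-vanishes j _ n<j)) (≗⇒≈ λ i → +-identityʳ _))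

geometric-stable : ∀ j .{{_ : NonZero j}} {m n} → m ≤ n → geometric j m ≈[ m ] geometric j n
geometric-stable j m≤n = shift-fixpoint-unique j (geometric-rec j ≤-refl) (geometric-rec j m≤n)

-- Sums and products over part sizes

-- sumRange off N ψ and prodRange off N ρ run over the indices off + 1, …, off + N.
sumRange : ℕ → ℕ → (ℕ → Series) → Series
sumRange off zero    ψ = 0ˢ
sumRange off (suc N) ψ = ψ (suc off) ⊞ sumRange (suc off) N ψ

prodRange : ℕ → ℕ → (ℕ → Series) → Series
prodRange off zero    ρ = 1ˢ
prodRange off (suc N) ρ = ρ (suc off) ⊛ prodRange (suc off) N ρ

power : ℕ → Series → Series
power l X = prodRange 0 l (λ _ → X)

sumRange-≗ : ∀ off N {ψ ψ′} → (∀ j → ψ j ≗ ψ′ j) → sumRange off N ψ ≗ sumRange off N ψ′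
sumRange-≗ off zero    p i = refl
sumRange-≗ off (suc N) p i = cong₂ _+_ (p (suc off) i) (sumRange-≗ (suc off) N p i)

sumRange-scale : ∀ off N c ψ → sumRange off N (λ j → scale c (ψ j)) ≗ scale c (sumRange off N ψ)
sumRange-scale off zero    c ψ i = sym (*-zeroʳ c)
sumRange-scale off (suc N) c ψ i rewrite sumRange-scale (suc off) N c ψ i =
  sym (*-distribˡ-+ c (ψ (suc off) i) _)

sumRange-const : ∀ off N Ψ → sumRange off N (λ _ → Ψ) ≗ scale N Ψ
sumRange-const off zero    Ψ i = refl
sumRange-const off (suc N) Ψ i = cong (Ψ i +_) (sumRange-const (suc off) N Ψ i)

module _ (k : ℕ) (Z : Series) where

  indicator : ℕ → Series
  indicator j = if j ≡ᵇ k then Z else 0ˢ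

  indicator-≢ : ∀ {j} → j ≢ k → indicator j ≡ 0ˢ
  indicator-≢ {j} j≢k with j ≡ᵇ k | ≡ᵇ⇒≡ j k
  ... | true  | j≡k = ⊥-elim (j≢k (j≡k tt))
  ... | false | _   = refl

  indicator-≡ : indicator k ≡ Z
  indicator-≡ with k ≡ᵇ k | ≡⇒≡ᵇ k k refl
  ... | true  | _ = refl

  sumRange-indicator-below : ∀ off N → k ≤ off → sumRange off N indicator ≗ 0ˢ
  sumRange-indicator-below off zero    k≤off i = refl
  sumRange-indicator-below off (suc N) k≤off i =
    cong₂ _+_ (cong (λ f → f i) (indicator-≢ (λ e → <-irrefl (sym e) (s≤s k≤off))))
              (sumRange-indicator-below (suc off) N (m≤n⇒m≤1+n k≤off) i)

  sumRange-indicator-above : ∀ off N → off + N < k → sumRange off N indicator ≗ 0ˢ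
  sumRange-indicator-above off zero    _ i = refl
  sumRange-indicator-above off (suc N) h i =
    cong₂ _+_ (cong (λ f → f i) (indicator-≢ (λ e → <-irrefl e (≤-<-trans off<off+N h))))
              (sumRange-indicator-above (suc off) N (subst (_< k) (+-suc off N) h) i)
    where
    off<off+N : suc off ≤ off + suc N
    off<off+N = subst (suc off ≤_) (sym (+-suc off N)) (s≤s (m≤m+n off N))

  sumRange-indicator-inside : ∀ off N → off < k → k ≤ off + N → sumRange off N indicator ≗ Z
  sumRange-indicator-inside off zero    off<k k≤off _ =
    ⊥-elim (<-irrefl refl (<-≤-trans off<k (subst (k ≤_) (+-identityʳ off) k≤off)))
  sumRange-indicator-inside off (suc N) off<k k≤ i with suc off ≟ k
  ... | yes refl = begin
    indicator k i + sumRange k N indicator i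
      ≡⟨ cong₂ _+_ (cong (λ f → f i) indicator-≡) (sumRange-indicator-below k N ≤-refl i) ⟩
    Z i + 0
      ≡⟨ +-identityʳ (Z i) ⟩
    Z i
      ∎
    where open ≡-Reasoning
  ... | no sucoff≢k rewrite indicator-≢ sucoff≢k =
    sumRange-indicator-inside (suc off) N (≤∧≢⇒< off<k sucoff≢k) (subst (k ≤_) (+-suc off N) k≤) i

  sumRange-indicator : ∀ {n} → 1 ≤ k → (n < k → Z ≈[ n ] 0ˢ) → sumRange 0 n indicator ≈[ n ] Z
  sumRange-indicator {n} 1≤k Z≈0 with k ≤? n
  ... | yes k≤n = ≗⇒≈ (sumRange-indicator-inside 0 n 1≤k k≤n)
  ... | no  k≰n = ≈-trans (≗⇒≈ (sumRange-indicator-above 0 n (≰⇒> k≰n))) (≈-sym (Z≈0 (≰⇒> k≰n)))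

prodRange-⊛ : ∀ off N ρ σ → prodRange off N (λ j → ρ j ⊛ σ j) ≗ prodRange off N ρ ⊛ prodRange off N σ
prodRange-⊛ off zero    ρ σ i = sym (⊛-identityˡ 1ˢ i)
prodRange-⊛ off (suc N) ρ σ i =
  trans (⊛-cong-≗ (λ _ → refl) (prodRange-⊛ (suc off) N ρ σ) i)
        (⊛-interchange (ρ (suc off)) (σ (suc off)) (prodRange (suc off) N ρ) (prodRange (suc off) N σ) i)

prodRange-cong : ∀ off N {ρ σ n} → (∀ o → ρ (suc o) ≈[ n ] σ (suc o)) →
                 prodRange off N ρ ≈[ n ] prodRange off N σ
prodRange-cong off zero    p = ≈-refl
prodRange-cong off (suc N) p = ⊛-cong (p off) (prodRange-cong (suc off) N p)

prodRange-at-0 : ∀ off N ρ → (∀ o → ρ (suc o) 0 ≡ 1) → prodRange off N ρ 0 ≡ 1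
prodRange-at-0 off zero    ρ h = refl
prodRange-at-0 off (suc N) ρ h rewrite h off | prodRange-at-0 (suc off) N ρ h = refl

module _ {n : ℕ} (ρ : ℕ → Series) (trivial : ∀ o → n ≤ o → ρ (suc o) ≈[ n ] 1ˢ) where

  prodRange-trivial : ∀ off M → n ≤ off → prodRange off M ρ ≈[ n ] 1ˢ
  prodRange-trivial off zero    _    = ≈-refl
  prodRange-trivial off (suc M) n≤off =
    ≈-trans (⊛-cong (trivial off n≤off) (prodRange-trivial (suc off) M (m≤n⇒m≤1+n n≤off)))
            (≗⇒≈ (⊛-identityˡ 1ˢ))

  prodRange-truncate : ∀ off N M → n ≤ off + N → prodRange off N ρ ≈[ n ] prodRange off (N + M) ρ
  prodRange-truncate off zero    M n≤off =
    ≈-sym (prodRange-trivial off M (subst (n ≤_) (+-identityʳ off) n≤off))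
  prodRange-truncate off (suc N) M n≤   =
    ⊛-cong {ρ (suc off)} ≈-refl (prodRange-truncate (suc off) N M (subst (n ≤_) (+-suc off N) n≤))

power-⊛ : ∀ l X Y → power l X ⊛ power l Y ≗ power l (X ⊛ Y)
power-⊛ l X Y i = sym (prodRange-⊛ 0 l (λ _ → X) (λ _ → Y) i)

power-cong : ∀ l {X Y n} → X ≈[ n ] Y → power l X ≈[ n ] power l Y
power-cong l p = prodRange-cong 0 l (λ _ → p)

power-≗ : ∀ l {X Y} → X ≗ Y → power l X ≗ power l Y
power-≗ l X≗Y d = power-cong l (≗⇒≈ X≗Y) d ≤-refl

power-at-0 : ∀ l X → X 0 ≡ 1 → power l X 0 ≡ 1
power-at-0 l X X0≡1 = prodRange-at-0 0 l (λ _ → X) (λ _ → X0≡1)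

power-1ˢ : ∀ l → power l 1ˢ ≗ 1ˢ
power-1ˢ = go 0
  where
  go : ∀ off l → prodRange off l (λ _ → 1ˢ) ≗ 1ˢ
  go off zero    i = refl
  go off (suc l) i = trans (⊛-identityˡ _ i) (go (suc off) l i)

prodRange-≗ : ∀ off N {ρ σ} → (∀ o → ρ (suc o) ≗ σ (suc o)) → prodRange off N ρ ≗ prodRange off N σ
prodRange-≗ off N p i = prodRange-cong off N (λ o → ≗⇒≈ (p o)) i ≤-refl

prodRange-stable : ∀ {m n ρ σ} → m ≤ n →
  (∀ o → ρ (suc o) ≈[ m ] σ (suc o)) → (∀ o → m ≤ o → σ (suc o) ≈[ m ] 1ˢ) →
  prodRange 0 m ρ ≈[ m ] prodRange 0 n σ
prodRange-stable {m} {n} {ρ} {σ} m≤n ρ≈σ σ-trivial = begin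
  prodRange 0 m ρ               ≈⟨ prodRange-cong 0 m ρ≈σ ⟩
  prodRange 0 m σ               ≈⟨ prodRange-truncate σ σ-trivial 0 m (n ∸ m) ≤-refl ⟩
  prodRange 0 (m + (n ∸ m)) σ   ≡⟨ cong (λ l → prodRange 0 l σ) (m+[n∸m]≡n m≤n) ⟩
  prodRange 0 n σ               ∎
  where open ≈-Reasoning m

-- Geometric series in q^k

geometric⁺ : ℕ → ℕ → Series
geometric⁺ k n = shift k (geometric k n)

isOdd : ℕ → Bool
isOdd zero          = false
isOdd (suc zero)    = true
isOdd (suc (suc m)) = isOdd m

isOdd-suc : ∀ m → isOdd (suc m) ≡ not (isOdd m)
isOdd-suc zero          = refl
isOdd-suc (suc zero)    = refl
isOdd-suc (suc (suc m)) = isOdd-suc m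

oddTerm : ℕ → ℕ → Series
oddTerm k j = if isOdd j then shift (j * k) 1ˢ else 0ˢ

module _ (k : ℕ) .{{_ : NonZero k}} (n : ℕ) where

  geometric⁺-rec : geometric⁺ k n ≈[ n ] shift k 1ˢ ⊞ shift k (geometric⁺ k n)
  geometric⁺-rec = ≈-trans (shift-cong k (geometric-rec k ≤-refl)) (≗⇒≈ (shift-⊞ k 1ˢ _))

  -- Both sides solve U = q^k E + q^k U, where E = 1/(1 - q^k).
  partGF-id-density : HasDensity 1ˢ n (geometric⁺ k n) (geometric k n) (partGF k n (λ x → x))
  partGF-id-density = ≈-trans (≗⇒≈ (⊛-identityˡ D)) (shift-fixpoint-unique k D-rec A⊛E-rec)
    where
    open ≈-Reasoning n
    E = geometric k n
    D = partGF k n (λ x → x)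
    A = geometric⁺ k n
    D-rec : D ≈[ n ] shift k E ⊞ shift k D
    D-rec = ≈-trans (partGF-id-rec k ≤-refl) (≗⇒≈ (shift-⊞ k E D))
    E⊛E-rec : E ⊛ E ≈[ n ] E ⊞ A ⊛ E
    E⊛E-rec = begin
      E ⊛ E                    ≈⟨ ⊛-cong (geometric-rec k ≤-refl) ≈-refl ⟩
      (1ˢ ⊞ shift k E) ⊛ E     ≈⟨ ≗⇒≈ (⊛-distribʳ-⊞ 1ˢ (shift k E) E) ⟩
      1ˢ ⊛ E ⊞ shift k E ⊛ E   ≈⟨ ⊞-cong (≗⇒≈ (⊛-identityˡ E)) ≈-refl ⟩
      E ⊞ A ⊛ E                ∎
    A⊛E-rec : A ⊛ E ≈[ n ] shift k E ⊞ shift k (A ⊛ E)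
    A⊛E-rec = begin
      A ⊛ E                         ≈⟨ ≗⇒≈ (⊛-shiftˡ k E E) ⟩
      shift k (E ⊛ E)               ≈⟨ shift-cong k E⊛E-rec ⟩
      shift k (E ⊞ A ⊛ E)           ≈⟨ ≗⇒≈ (shift-⊞ k E (A ⊛ E)) ⟩
      shift k E ⊞ shift k (A ⊛ E)   ∎

  sumRange-multiples : ∀ N off → n ≤ off + N →
    sumRange off N (λ j → shift (j * k) 1ˢ) ≈[ n ] shift (suc off * k) (geometric k n)
  sumRange-multiples zero off n≤off = ≈-sym (shift-vanishes (suc off * k) _ n<)
    where n< = ≤-trans (s≤s (subst (n ≤_) (+-identityʳ off) n≤off)) (m≤m*n (suc off) k)
  sumRange-multiples (suc N) off n≤ = begin
    shift c 1ˢ ⊞ sumRange (suc off) N _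
      ≈⟨ ⊞-cong ≈-refl (sumRange-multiples N (suc off) (subst (n ≤_) (+-suc off N) n≤)) ⟩
    shift c 1ˢ ⊞ shift (k + c) E
      ≈⟨ ⊞-cong ≈-refl (≗⇒≈ shift-k+c) ⟩
    shift c 1ˢ ⊞ shift c (shift k E)
      ≈⟨ ≗⇒≈ (λ i → sym (shift-⊞ c 1ˢ (shift k E) i)) ⟩
    shift c (1ˢ ⊞ shift k E)
      ≈⟨ shift-cong c (geometric-rec k ≤-refl) ⟨
    shift c E
      ∎
    where
    open ≈-Reasoning n
    E = geometric k n
    c = suc off * k
    shift-k+c : shift (k + c) E ≗ shift c (shift k E)
    shift-k+c i = trans (cong (λ d → shift d E i) (+-comm k c)) (sym (shift-+ c k E i))

  geometric⁺-as-sum : sumRange 0 n (λ j → shift (j * k) 1ˢ) ≈[ n ] geometric⁺ k n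
  geometric⁺-as-sum = ≈-trans (sumRange-multiples n 0 ≤-refl)
                              (≗⇒≈ (λ i → cong (λ c → shift c (geometric k n) i) (*-identityˡ k)))

  geometric-unfold₂ : ∀ c → shift c 1ˢ ⊞ shift k (shift c 1ˢ) ⊞ shift (k + (k + c)) (geometric k n)
                            ≈[ n ] shift c (geometric k n)
  geometric-unfold₂ c = begin
    shift c 1ˢ ⊞ shift k (shift c 1ˢ) ⊞ shift (k + (k + c)) E
      ≈⟨ ≗⇒≈ (λ i → cong₂ (λ x y → shift c 1ˢ i + x + y) (shift-comm k c 1ˢ i) (shifts i)) ⟩
    shift c 1ˢ ⊞ shift c (shift k 1ˢ) ⊞ shift c (shift k (shift k E))
      ≈⟨ ≗⇒≈ (λ i → trans (+-assoc (shift c 1ˢ i) _ _)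
                          (sym (trans (shift-⊞ c 1ˢ _ i) (cong (shift c 1ˢ i +_) (shift-⊞ c (shift k 1ˢ) _ i))))) ⟩
    shift c (1ˢ ⊞ (shift k 1ˢ ⊞ shift k (shift k E)))
      ≈⟨ ≗⇒≈ (shift-≗ c (λ i → cong (1ˢ i +_) (sym (shift-⊞ k 1ˢ (shift k E) i)))) ⟩
    shift c (1ˢ ⊞ shift k (1ˢ ⊞ shift k E))
      ≈⟨ shift-cong c (⊞-cong ≈-refl (shift-cong k (geometric-rec k ≤-refl))) ⟨
    shift c (1ˢ ⊞ shift k E)
      ≈⟨ shift-cong c (geometric-rec k ≤-refl) ⟨
    shift c E
      ∎
    where
    open ≈-Reasoning n
    E = geometric k n
    shifts : shift (k + (k + c)) E ≗ shift c (shift k (shift k E))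
    shifts i = trans (cong (λ d → shift d E i) (reorder k c))
                     (sym (trans (shift-≗ c (shift-+ k k E) i) (shift-+ c (k + k) E i)))
      where
      reorder : ∀ k c → k + (k + c) ≡ c + (k + k)
      reorder = solve-∀

  -- Each odd multiple j k is paired with the even multiple (j + 1) k.
  private
    doubled : ℕ → ℕ → Series
    doubled off N = sumRange off N (oddTerm k) ⊞ shift k (sumRange off N (oddTerm k))

    doubled-suc : ∀ off N →
      doubled off (suc N) ≗ oddTerm k (suc off) ⊞ shift k (oddTerm k (suc off)) ⊞ doubled (suc off) N
    doubled-suc off N i rewrite shift-⊞ k (oddTerm k (suc off)) (sumRange (suc off) N (oddTerm k)) i =
      +-interchange (oddTerm k (suc off) i) _ _ _

    doubled-zero : ∀ off c → n < c → doubled off 0 ≈[ n ] shift c (geometric k n)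
    doubled-zero off c n<c = ≈-trans (≗⇒≈ (shift-0ˢ k)) (≈-sym (shift-vanishes c _ n<c))

    oddTerm-odd : ∀ j → isOdd j ≡ true → oddTerm k j ≡ shift (j * k) 1ˢ
    oddTerm-odd j e rewrite e = refl

    oddTerm-even : ∀ j → isOdd j ≡ false → oddTerm k j ≡ 0ˢ
    oddTerm-even j e rewrite e = refl

    below-multiple : ∀ {off} m → n ≤ off + 0 → n < suc (m + off) * k
    below-multiple {off} m n≤ =
      ≤-trans (s≤s (≤-trans (subst (n ≤_) (+-identityʳ off) n≤) (m≤n+m off m))) (m≤m*n _ k)

  mutual
    doubled-from-odd : ∀ N off → isOdd (suc off) ≡ true → n ≤ off + N →
                       doubled off N ≈[ n ] shift (suc off * k) (geometric k n)
    doubled-from-odd zero    off _   n≤ = doubled-zero off _ (below-multiple 0 n≤)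
    doubled-from-odd (suc N) off odd n≤ = begin
      doubled off (suc N)
        ≈⟨ ≗⇒≈ (doubled-suc off N) ⟩
      oddTerm k (suc off) ⊞ shift k (oddTerm k (suc off)) ⊞ doubled (suc off) N
        ≡⟨ cong (λ t → t ⊞ shift k t ⊞ doubled (suc off) N) (oddTerm-odd (suc off) odd) ⟩
      shift c 1ˢ ⊞ shift k (shift c 1ˢ) ⊞ doubled (suc off) N
        ≈⟨ ⊞-cong ≈-refl (doubled-from-even N (suc off) (trans (isOdd-suc (suc off)) (cong not odd)) n≤′) ⟩
      shift c 1ˢ ⊞ shift k (shift c 1ˢ) ⊞ shift (k + (k + c)) (geometric k n)
        ≈⟨ geometric-unfold₂ c ⟩
      shift c (geometric k n)
        ∎
      where
      open ≈-Reasoning n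
      c = suc off * k
      n≤′ = subst (n ≤_) (+-suc off N) n≤

    doubled-from-even : ∀ N off → isOdd (suc off) ≡ false → n ≤ off + N →
                        doubled off N ≈[ n ] shift (suc (suc off) * k) (geometric k n)
    doubled-from-even zero    off _    n≤ = doubled-zero off _ (below-multiple 1 n≤)
    doubled-from-even (suc N) off even n≤ = begin
      doubled off (suc N)
        ≈⟨ ≗⇒≈ (doubled-suc off N) ⟩
      oddTerm k (suc off) ⊞ shift k (oddTerm k (suc off)) ⊞ doubled (suc off) N
        ≡⟨ cong (λ t → t ⊞ shift k t ⊞ doubled (suc off) N) (oddTerm-even (suc off) even) ⟩
      0ˢ ⊞ shift k 0ˢ ⊞ doubled (suc off) N
        ≈⟨ ≗⇒≈ (λ i → cong (_+ doubled (suc off) N i) (shift-0ˢ k i)) ⟩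
      doubled (suc off) N
        ≈⟨ doubled-from-odd N (suc off) (trans (isOdd-suc (suc off)) (cong not even)) (subst (n ≤_) (+-suc off N) n≤) ⟩
      shift (suc (suc off) * k) (geometric k n)
        ∎
      where open ≈-Reasoning n

  oddSum : Series
  oddSum = sumRange 0 n (oddTerm k)

  oddSum-⊞-shift : oddSum ⊞ shift k oddSum ≈[ n ] geometric⁺ k n
  oddSum-⊞-shift = ≈-trans (doubled-from-odd n 0 refl ≤-refl)
                           (≗⇒≈ (λ i → cong (λ c → shift c (geometric k n) i) (*-identityˡ k)))

  oddSum-rec : oddSum ≈[ n ] shift k 1ˢ ⊞ shift (k + k) oddSum
  oddSum-rec i i≤n = +-cancelʳ-≡ (shift k oddSum i) (oddSum i) _ (trans (both i i≤n) (rearrange i))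
    where
    open ≈-Reasoning n
    both : oddSum ⊞ shift k oddSum ≈[ n ] shift k 1ˢ ⊞ shift k (oddSum ⊞ shift k oddSum)
    both = begin
      oddSum ⊞ shift k oddSum                       ≈⟨ oddSum-⊞-shift ⟩
      geometric⁺ k n                                ≈⟨ geometric⁺-rec ⟩
      shift k 1ˢ ⊞ shift k (geometric⁺ k n)         ≈⟨ ⊞-cong ≈-refl (shift-cong k oddSum-⊞-shift) ⟨
      shift k 1ˢ ⊞ shift k (oddSum ⊞ shift k oddSum) ∎
    rearrange : shift k 1ˢ ⊞ shift k (oddSum ⊞ shift k oddSum) ≗ shift k 1ˢ ⊞ shift (k + k) oddSum ⊞ shift k oddSum
    rearrange i rewrite shift-⊞ k oddSum (shift k oddSum) i | shift-+ k k oddSum i =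
      trans (cong (shift k 1ˢ i +_) (+-comm (shift k oddSum i) _)) (sym (+-assoc (shift k 1ˢ i) _ _))

-- Euler's identity

-- (1 + q^j) / (1 - q^2j) = 1 / (1 - q^j): both sides solve U = 1 + q^j U.
distinct⊛geometric : ∀ o n → partGF (suc o) 1 (λ _ → 1) ⊛ geometric (suc o + suc o) n ≈[ n ] geometric (suc o) n
distinct⊛geometric o n = shift-fixpoint-unique j U-rec (geometric-rec j ≤-refl)
  where
  j = suc o
  E₂ = geometric (j + j) n
  U = partGF j 1 (λ _ → 1) ⊛ E₂
  U≗ : U ≗ E₂ ⊞ shift j E₂
  U≗ i = begin
    (partGF j 1 (λ _ → 1) ⊛ E₂) i          ≡⟨ ⊛-cong-≗ (partGF-bound-1 j (λ _ → 1)) (λ _ → refl) i ⟩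
    ((1ˢ ⊞ shift j 1ˢ) ⊛ E₂) i             ≡⟨ ⊛-distribʳ-⊞ 1ˢ (shift j 1ˢ) E₂ i ⟩
    (1ˢ ⊛ E₂) i + (shift j 1ˢ ⊛ E₂) i      ≡⟨ cong₂ _+_ (⊛-identityˡ E₂ i) (shift-1ˢ-⊛ j E₂ i) ⟩
    E₂ i + shift j E₂ i                    ∎
    where open ≡-Reasoning
  U-rec : U ≈[ n ] 1ˢ ⊞ shift j U
  U-rec = begin
    U                                          ≈⟨ ≗⇒≈ U≗ ⟩
    E₂ ⊞ shift j E₂                            ≈⟨ ⊞-cong (geometric-rec (j + j) ≤-refl) ≈-refl ⟩
    1ˢ ⊞ shift (j + j) E₂ ⊞ shift j E₂         ≈⟨ ≗⇒≈ rearrange ⟩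
    1ˢ ⊞ shift j (E₂ ⊞ shift j E₂)             ≈⟨ ⊞-cong ≈-refl (≗⇒≈ (shift-≗ j U≗)) ⟨
    1ˢ ⊞ shift j U                             ∎
    where
    open ≈-Reasoning n
    rearrange : 1ˢ ⊞ shift (j + j) E₂ ⊞ shift j E₂ ≗ 1ˢ ⊞ shift j (E₂ ⊞ shift j E₂)
    rearrange i rewrite shift-⊞ j E₂ (shift j E₂) i | shift-+ j j E₂ i =
      trans (+-assoc (1ˢ i) _ _) (cong (1ˢ i +_) (+-comm (shift (j + j) E₂ i) _))

oddPartCount : Bool → ℕ → ℕ
oddPartCount t x = boolToℕ (t ∨ (x ≡ᵇ 0))

double : ℕ → ℕ
double zero    = zero
double (suc t) = suc (suc (double t))

double≡+ : ∀ t → double t ≡ t + t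
double≡+ zero    = refl
double≡+ (suc t) = cong suc (trans (cong suc (double≡+ t)) (sym (+-suc t t)))

isOdd-double : ∀ t → isOdd (double t) ≡ false
isOdd-double zero    = refl
isOdd-double (suc t) = isOdd-double t

isOdd-suc-double : ∀ t → isOdd (suc (double t)) ≡ true
isOdd-suc-double zero    = refl
isOdd-suc-double (suc t) = isOdd-suc-double t

module _ (s n : ℕ) where

  distinctRow oddRow evenFactor halvedFactor : ℕ → Series
  distinctRow  j = power s (partGF j 1 (λ _ → 1))
  oddRow       j = power s (partGF j n (oddPartCount (isOdd j)))
  evenFactor   j = if isOdd j then 1ˢ else power s (geometric j n)
  halvedFactor j = power s (geometric (j + j) n)

  private
    evenFactor-odd : ∀ j → isOdd j ≡ true → evenFactor j ≡ 1ˢ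
    evenFactor-odd j e rewrite e = refl

    evenFactor-even : ∀ j → isOdd j ≡ false → evenFactor j ≡ power s (geometric j n)
    evenFactor-even j e rewrite e = refl

  oddRow⊛evenFactor : ∀ o → oddRow (suc o) ⊛ evenFactor (suc o) ≈[ n ] power s (geometric (suc o) n)
  oddRow⊛evenFactor o with isOdd (suc o)
  ... | true  = ≗⇒≈ λ i → trans (⊛-comm _ 1ˢ i) (⊛-identityˡ _ i)
  ... | false = ≗⇒≈ λ i → trans (⊛-cong-≗ trivial (λ _ → refl) i) (⊛-identityˡ _ i)
    where
    trivial : power s (partGF (suc o) n (oddPartCount false)) ≗ 1ˢ
    trivial d = trans (power-≗ s (partGF-only-zero (suc o) n) d) (power-1ˢ s d)

  evenFactor-at-0 : ∀ o → evenFactor (suc o) 0 ≡ 1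
  evenFactor-at-0 o with isOdd (suc o)
  ... | true  = refl
  ... | false = power-at-0 s _ (partGF-at-0 (suc o) {n} {n} ≤-refl (λ _ → 1))

  evenFactor-trivial : ∀ o → n ≤ o → evenFactor (suc o) ≈[ n ] 1ˢ
  evenFactor-trivial o n≤o with isOdd (suc o)
  ... | true  = ≈-refl
  ... | false = ≈-trans (power-cong s (geometric-trivial (suc o) ≤-refl (s≤s n≤o))) (≗⇒≈ (power-1ˢ s))

  evenFactors≗halvedFactors : ∀ m t → prodRange (double t) (double m) evenFactor ≗ prodRange t m halvedFactor
  evenFactors≗halvedFactors zero    t i = refl
  evenFactors≗halvedFactors (suc m) t i = begin
    (evenFactor (suc (double t)) ⊛ (evenFactor (double (suc t)) ⊛ rest)) i
      ≡⟨ cong (λ f → (f ⊛ (evenFactor (double (suc t)) ⊛ rest)) i) (evenFactor-odd (suc (double t)) (isOdd-suc-double t)) ⟩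
    (1ˢ ⊛ (evenFactor (double (suc t)) ⊛ rest)) i
      ≡⟨ ⊛-identityˡ _ i ⟩
    (evenFactor (double (suc t)) ⊛ rest) i
      ≡⟨ cong (λ f → (f ⊛ rest) i) even≡halved ⟩
    (halvedFactor (suc t) ⊛ rest) i
      ≡⟨ ⊛-cong-≗ (λ _ → refl) (evenFactors≗halvedFactors m (suc t)) i ⟩
    (halvedFactor (suc t) ⊛ prodRange (suc t) m halvedFactor) i
      ∎
    where
    open ≡-Reasoning
    rest = prodRange (double (suc t)) (double m) evenFactor
    even≡halved : evenFactor (double (suc t)) ≡ halvedFactor (suc t)
    even≡halved = trans (evenFactor-even (double (suc t)) (isOdd-double (suc t)))
                        (cong (λ j → power s (geometric j n)) (double≡+ (suc t)))

  halvedFactors≈evenFactors : prodRange 0 n halvedFactor ≈[ n ] prodRange 0 n evenFactor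
  halvedFactors≈evenFactors = ≈-sym (begin
    prodRange 0 n evenFactor              ≈⟨ prodRange-truncate evenFactor evenFactor-trivial 0 n n ≤-refl ⟩
    prodRange 0 (n + n) evenFactor        ≡⟨ cong (λ m → prodRange 0 m evenFactor) (sym (double≡+ n)) ⟩
    prodRange 0 (double n) evenFactor     ≈⟨ ≗⇒≈ (evenFactors≗halvedFactors n 0) ⟩
    prodRange 0 n halvedFactor            ∎)
    where open ≈-Reasoning n

  -- Multiplied by the product of (1 - q^j)^-s over even j, both sides become ∏ⱼ (1 - q^j)^-s.
  euler : prodRange 0 n distinctRow ≈[ n ] prodRange 0 n oddRow
  euler = ⊛-cancelˡ {prodRange 0 n evenFactor} (prodRange-at-0 0 n evenFactor evenFactor-at-0) (begin
    prodRange 0 n evenFactor ⊛ prodRange 0 n distinctRow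
      ≈⟨ ≗⇒≈ (⊛-comm _ _) ⟩
    prodRange 0 n distinctRow ⊛ prodRange 0 n evenFactor
      ≈⟨ ⊛-cong {prodRange 0 n distinctRow} ≈-refl
                                                                        halvedFactors≈evenFactors ⟨
    prodRange 0 n distinctRow ⊛ prodRange 0 n halvedFactor
      ≈⟨ ≗⇒≈ (λ i → sym (prodRange-⊛ 0 n distinctRow halvedFactor i)) ⟩
    prodRange 0 n (λ j → distinctRow j ⊛ halvedFactor j)
      ≈⟨ prodRange-cong 0 n distinct⊛halved ⟩
    prodRange 0 n (λ j → power s (geometric j n))
      ≈⟨ prodRange-cong 0 n (λ o → ≈-sym (oddRow⊛evenFactor o)) ⟩
    prodRange 0 n (λ j → oddRow j ⊛ evenFactor j)
      ≈⟨ ≗⇒≈ (prodRange-⊛ 0 n oddRow evenFactor) ⟩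
    prodRange 0 n oddRow ⊛ prodRange 0 n evenFactor
      ≈⟨ ≗⇒≈ (⊛-comm _ _) ⟩
    prodRange 0 n evenFactor ⊛ prodRange 0 n oddRow
      ∎)
    where
    open ≈-Reasoning n
    distinct⊛halved : ∀ o → distinctRow (suc o) ⊛ halvedFactor (suc o) ≈[ n ] power s (geometric (suc o) n)
    distinct⊛halved o = ≈-trans (≗⇒≈ (power-⊛ s _ _)) (power-cong s (distinct⊛geometric o n))

-- Vectors, rows and tables

module _ {E : Set} (L : List E)
         (w : ℕ → E → ℕ) (W : ℕ → ∀ {N} → Vec E N → ℕ)
         (W-[] : ∀ o → W o [] ≡ 0)
         (W-∷ : ∀ o {N} e (v : Vec E N) → W o (e ∷ v) ≡ w (suc o) e + W (suc o) v)
         (a : ℕ → E → Bool) (A : ℕ → ∀ {N} → Vec E N → Bool)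
         (A-[] : ∀ o → A o [] ≡ true)
         (A-∷ : ∀ o {N} e (v : Vec E N) → A o (e ∷ v) ≡ a (suc o) e ∧ A (suc o) v)
         where

  private
    count-∷ : ∀ o {N} e (v : Vec E N) →
              boolToℕ (A o (e ∷ v)) ≡ boolToℕ (a (suc o) e) * boolToℕ (A (suc o) v)
    count-∷ o e v = trans (cong boolToℕ (A-∷ o e v)) (boolToℕ-∧ (a (suc o) e) (A (suc o) v))

  vectors-count : ∀ N off → gf (allVec L N) (W off) (λ v → boolToℕ (A off v))
                            ≗ prodRange off N (λ j → gf L (w j) (λ e → boolToℕ (a j e)))
  vectors-count zero    off d rewrite W-[] off | A-[] off = trans (+-identityʳ _) (monomial-zero 1 d)
  vectors-count (suc N) off d =
    trans (gf-product _∷_ L (allVec L N) (W off) (λ v → boolToℕ (A off v))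
             (w (suc off)) (λ e → boolToℕ (a (suc off) e)) (W (suc off)) (λ v → boolToℕ (A (suc off) v))
             (W-∷ off) (count-∷ off) d)
          (⊛-cong-≗ (λ _ → refl) (vectors-count N (suc off)) d)

  module _ (σ : ℕ → E → ℕ) (Σ : ℕ → ∀ {N} → Vec E N → ℕ)
           (Σ-[] : ∀ o → Σ o [] ≡ 0)
           (Σ-∷ : ∀ o {N} e (v : Vec E N) → Σ o (e ∷ v) ≡ σ (suc o) e + Σ (suc o) v)
           where

    private
      stat-∷ : ∀ o {N} e (v : Vec E N) →
        guarded (A o (e ∷ v)) (Σ o (e ∷ v))
          ≡ guarded (a (suc o) e) (σ (suc o) e) * boolToℕ (A (suc o) v)
            + boolToℕ (a (suc o) e) * guarded (A (suc o) v) (Σ (suc o) v)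
      stat-∷ o e v rewrite A-∷ o e v | Σ-∷ o e v = guarded-∧-+ (a (suc o) e) _ _ _

    vectors-density : ∀ {P n Ψ} →
      (∀ o → HasDensity P n (Ψ (suc o)) (gf L (w (suc o)) (λ e → boolToℕ (a (suc o) e)))
                                        (gf L (w (suc o)) (λ e → guarded (a (suc o) e) (σ (suc o) e)))) →
      ∀ N off → HasDensity P n (sumRange off N Ψ) (gf (allVec L N) (W off) (λ v → boolToℕ (A off v)))
                                                  (gf (allVec L N) (W off) (λ v → guarded (A off v) (Σ off v)))
    vectors-density entry zero    off = density-zero λ d → begin
      monomial (W off []) (guarded (A off []) (Σ off [])) d + 0  ≡⟨ +-identityʳ _ ⟩
      monomial (W off []) (guarded (A off []) (Σ off [])) d      ≡⟨ cong (λ x → monomial (W off []) x d) empty ⟩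
      monomial (W off []) 0 d                                    ≡⟨ monomial-0 (W off []) d ⟩
      0                                                          ∎
      where
      open ≡-Reasoning
      empty : guarded (A off []) (Σ off []) ≡ 0
      empty rewrite A-[] off = Σ-[] off
    vectors-density entry (suc N) off =
      gf-density-product _∷_ L (allVec L N) (W off) (λ v → boolToℕ (A off v)) (λ v → guarded (A off v) (Σ off v))
        (w (suc off)) (λ e → boolToℕ (a (suc off) e)) (λ e → guarded (a (suc off) e) (σ (suc off) e))
        (W (suc off)) (λ v → boolToℕ (A (suc off) v)) (λ v → guarded (A (suc off) v) (Σ (suc off) v))
        (W-∷ off) (count-∷ off) (stat-∷ off) (entry off) (vectors-density entry N (suc off))

-- A row: the multiplicities x ∈ U, one for each color, of the parts of size j.
module _ (U : List ℕ) (j : ℕ)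
         (a : ℕ → Bool) (A : ∀ {l} → Vec ℕ l → Bool)
         (A-[] : A [] ≡ true) (A-∷ : ∀ {l} x (v : Vec ℕ l) → A (x ∷ v) ≡ a x ∧ A v)
         where

  row-count : ∀ l → gf (allVec U l) (λ v → j * vsum v) (λ v → boolToℕ (A v))
                    ≗ power l (gf U (j *_) (λ x → boolToℕ (a x)))
  row-count l = vectors-count U (λ _ x → j * x) (λ _ v → j * vsum v) (λ _ → *-zeroʳ j)
                  (λ _ x v → *-distribˡ-+ j x (vsum v)) (λ _ → a) (λ _ → A) (λ _ → A-[]) (λ _ → A-∷) l 0

  row-density : ∀ (σ : ℕ → ℕ) (Σ : ∀ {l} → Vec ℕ l → ℕ) →
    Σ [] ≡ 0 → (∀ {l} x (v : Vec ℕ l) → Σ (x ∷ v) ≡ σ x + Σ v) →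
    ∀ {P n Ψ} → HasDensity P n Ψ (gf U (j *_) (λ x → boolToℕ (a x))) (gf U (j *_) (λ x → guarded (a x) (σ x))) →
    ∀ l → HasDensity P n (scale l Ψ) (gf (allVec U l) (λ v → j * vsum v) (λ v → boolToℕ (A v)))
                                     (gf (allVec U l) (λ v → j * vsum v) (λ v → guarded (A v) (Σ v)))
  row-density σ Σ Σ-[] Σ-∷ {Ψ = Ψ} entry l =
    density-cong (≗⇒≈ (sumRange-const 0 l Ψ)) (λ _ → refl) (λ _ → refl)
      (vectors-density U (λ _ x → j * x) (λ _ v → j * vsum v) (λ _ → *-zeroʳ j) (λ _ x v → *-distribˡ-+ j x (vsum v))
         (λ _ → a) (λ _ → A) (λ _ → A-[]) (λ _ → A-∷) (λ _ → σ) (λ _ → Σ) (λ _ → Σ-[]) (λ _ → Σ-∷)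
         (λ _ → entry) l 0)

-- The statistics of the theorem

module _ (k : ℕ) .{{_ : NonZero k}} (n : ℕ) where

  entry-size : ∀ o → HasDensity 1ˢ n (if suc o ≡ᵇ k then geometric⁺ k n else 0ˢ)
                                     (geometric (suc o) n) (partGF (suc o) n (λ x → guarded (suc o ≡ᵇ k) x))
  entry-size o with suc o ≡ᵇ k | ≡ᵇ⇒≡ (suc o) k
  ... | true  | j≡k = subst (λ j → HasDensity 1ˢ n (geometric⁺ k n) (geometric j n) (partGF j n (λ x → x)))
                            (sym (j≡k tt)) (partGF-id-density k n)
  ... | false | _   = density-zero (gf-zero (upTo (suc n)) (suc o *_))

  entry-atLeast : ∀ o → HasDensity 1ˢ n (shift (suc o * k) 1ˢ) (geometric (suc o) n) (partGF (suc o) n (atLeast k))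
  entry-atLeast o = begin
    1ˢ ⊛ partGF (suc o) n (atLeast k)      ≈⟨ ≗⇒≈ (⊛-identityˡ _) ⟩
    partGF (suc o) n (atLeast k)           ≈⟨ partGF-atLeast (suc o) ≤-refl k ⟩
    shift c (geometric (suc o) n)          ≈⟨ ≗⇒≈ (shift-1ˢ-⊛ c (geometric (suc o) n)) ⟨
    shift c 1ˢ ⊛ geometric (suc o) n       ∎
    where
    open ≈-Reasoning n
    c = suc o * k

  entry-distinct-size : ∀ o → HasDensity (1ˢ ⊞ shift k 1ˢ) n (if suc o ≡ᵇ k then shift k 1ˢ else 0ˢ)
                                         (partGF (suc o) 1 (λ _ → 1)) (partGF (suc o) 1 (λ x → guarded (suc o ≡ᵇ k) x))
  entry-distinct-size o with suc o ≡ᵇ k | ≡ᵇ⇒≡ (suc o) k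
  ... | true  | j≡k = subst (λ j → HasDensity (1ˢ ⊞ shift k 1ˢ) n (shift k 1ˢ)
                                              (partGF j 1 (λ _ → 1)) (partGF j 1 (λ x → x)))
                            (sym (j≡k tt)) (≗⇒≈ λ i → begin
    ((1ˢ ⊞ shift k 1ˢ) ⊛ partGF k 1 (λ x → x)) i   ≡⟨ ⊛-cong-≗ (λ _ → refl) part i ⟩
    ((1ˢ ⊞ shift k 1ˢ) ⊛ shift k 1ˢ) i             ≡⟨ ⊛-comm _ _ i ⟩
    (shift k 1ˢ ⊛ (1ˢ ⊞ shift k 1ˢ)) i             ≡⟨ ⊛-cong-≗ (λ _ → refl) (partGF-bound-1 k (λ _ → 1)) i ⟨
    (shift k 1ˢ ⊛ partGF k 1 (λ _ → 1)) i          ∎)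
    where
    open ≡-Reasoning
    part : partGF k 1 (λ x → x) ≗ shift k 1ˢ
    part d = trans (partGF-bound-1 k (λ x → x) d) (cong (_+ shift k 1ˢ d) (const-0 d))
  ... | false | _   = density-zero (gf-zero (upTo 2) (suc o *_))

  entry-odd-atLeast : ∀ o →
    HasDensity 1ˢ n (if isOdd (suc o) then shift (suc o * k) 1ˢ else 0ˢ) (partGF (suc o) n (oddPartCount (isOdd (suc o))))
                    (partGF (suc o) n (λ x → guarded (isOdd (suc o) ∨ (x ≡ᵇ 0)) (atLeast k x)))
  entry-odd-atLeast o with isOdd (suc o)
  ... | true  = entry-atLeast o
  ... | false = density-zero λ d → trans (gf-≗ (upTo (suc n)) (λ _ → refl) only-zero d) (gf-zero (upTo (suc n)) (suc o *_) d)
    where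
    only-zero : ∀ x → guarded (x ≡ᵇ 0) (atLeast k x) ≡ 0
    only-zero zero    = atLeast-0 k
    only-zero (suc x) = refl

  entry-odd-size : ∀ o →
    HasDensity 1ˢ n (if isOdd (suc o) then (if suc o ≡ᵇ k then geometric⁺ k n else 0ˢ) else 0ˢ)
                    (partGF (suc o) n (oddPartCount (isOdd (suc o))))
                    (partGF (suc o) n (λ x → guarded (isOdd (suc o) ∨ (x ≡ᵇ 0)) (guarded (suc o ≡ᵇ k) x)))
  entry-odd-size o with isOdd (suc o)
  ... | true  = entry-size o
  ... | false = density-zero λ d → trans (gf-≗ (upTo (suc n)) (λ _ → refl) only-zero d) (gf-zero (upTo (suc n)) (suc o *_) d)
    where
    only-zero : ∀ x → guarded (x ≡ᵇ 0) (guarded (suc o ≡ᵇ k) x) ≡ 0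
    only-zero zero    = guarded-0 (suc o ≡ᵇ k)
    only-zero (suc x) = refl

-- oddPartsFrom tests parity with a function local to Defs; single-row tables identify it with isOdd.
oddPartsFrom-∷ : ∀ {c} off {N} (row : Vec ℕ c) (rows : Vec (Vec ℕ c) N) →
                 oddPartsFrom off (row ∷ rows) ≡ (isOdd (suc off) ∨ allZero row) ∧ oddPartsFrom (suc off) rows
oddPartsFrom-∷ off row rows = cong (_∧ oddPartsFrom (suc off) rows)
  (trans (sym (∧-identityʳ _)) (trans (single off) (∧-identityʳ _)))
  where
  single : ∀ off → oddPartsFrom off (row ∷ []) ≡ (isOdd (suc off) ∨ allZero row) ∧ true
  single zero             = refl
  single (suc zero)       = refl
  single (suc (suc off))  = single off

module _ {X Y : Set} (L₁ : List X) (L₂ : List Y) (w₁ : X → ℕ) (w₂ : Y → ℕ) where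

  private
    wX : X × Y → ℕ
    wX p = w₁ (proj₁ p) + w₂ (proj₂ p)

  pairs-count : ∀ c₂ → gf (pairs L₁ L₂) wX (λ p → c₂ (proj₂ p)) ≗ gf L₁ w₁ (λ _ → 1) ⊛ gf L₂ w₂ c₂
  pairs-count c₂ = gf-product _,_ L₁ L₂ wX _ w₁ (λ _ → 1) w₂ c₂ (λ _ _ → refl) (λ _ _ → sym (*-identityˡ _))

  pairs-density-left : ∀ {P n Ψ} g₁ → HasDensity P n Ψ (gf L₁ w₁ (λ _ → 1)) (gf L₁ w₁ g₁) →
    HasDensity P n Ψ (gf (pairs L₁ L₂) wX (λ _ → 1)) (gf (pairs L₁ L₂) wX (λ p → g₁ (proj₁ p)))
  pairs-density-left g₁ h₁ = density-cong (≗⇒≈ (λ i → +-identityʳ _)) (λ _ → refl) (λ _ → refl)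
    (gf-density-product _,_ L₁ L₂ wX _ _ w₁ (λ _ → 1) g₁ w₂ (λ _ → 1) (λ _ → 0)
       (λ _ _ → refl) (λ _ _ → refl) (λ a _ → sym (trans (+-identityʳ _) (*-identityʳ (g₁ a))))
       h₁ (density-zero (gf-zero L₂ w₂)))

  pairs-density-right : ∀ {P n Ψ} c₂ g₂ → HasDensity P n Ψ (gf L₂ w₂ c₂) (gf L₂ w₂ g₂) →
    HasDensity P n Ψ (gf (pairs L₁ L₂) wX (λ p → c₂ (proj₂ p))) (gf (pairs L₁ L₂) wX (λ p → g₂ (proj₂ p)))
  pairs-density-right c₂ g₂ h₂ =
    gf-density-product _,_ L₁ L₂ wX _ _ w₁ (λ _ → 1) (λ _ → 0) w₂ c₂ g₂
       (λ _ _ → refl) (λ _ _ → sym (*-identityˡ _)) (λ _ _ → sym (*-identityˡ _))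
       (density-zero (gf-zero L₁ w₁)) h₂

multiplicityRows : (c b : ℕ) → List (Vec ℕ c)
multiplicityRows c b = allVec (upTo (suc b)) c

pairWeight : ∀ {N c d} → Table N c × Table N d → ℕ
pairWeight p = weight (proj₁ p) + weight (proj₂ p)

module _ {c b : ℕ} {P : Series} {n : ℕ} where

  plainTables-density : ∀ (σ : ℕ → Vec ℕ c → ℕ) (Σ : ℕ → ∀ {N} → Table N c → ℕ) →
    (∀ o → Σ o [] ≡ 0) → (∀ o {N} row (rows : Table N c) → Σ o (row ∷ rows) ≡ σ (suc o) row + Σ (suc o) rows) →
    ∀ {Ψ} → (∀ o → HasDensity P n (Ψ (suc o)) (gf (multiplicityRows c b) (λ v → suc o * vsum v) (λ _ → 1))
                                              (gf (multiplicityRows c b) (λ v → suc o * vsum v) (σ (suc o)))) →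
    HasDensity P n (sumRange 0 n Ψ) (gf (allTables n c b) weight (λ _ → 1)) (gf (allTables n c b) weight (Σ 0))
  plainTables-density σ Σ Σ-[] Σ-∷ rows =
    vectors-density (multiplicityRows c b) (λ j v → j * vsum v) (λ off v → weightFrom off v) (λ _ → refl) (λ _ _ _ → refl)
      (λ _ _ → true) (λ _ _ → true) (λ _ → refl) (λ _ _ _ → refl) σ Σ Σ-[] Σ-∷ rows n 0

  oddTables-density : ∀ (σ : ℕ → Vec ℕ c → ℕ) (Σ : ℕ → ∀ {N} → Table N c → ℕ) →
    (∀ o → Σ o [] ≡ 0) → (∀ o {N} row (rows : Table N c) → Σ o (row ∷ rows) ≡ σ (suc o) row + Σ (suc o) rows) →
    ∀ {Ψ} → (∀ o → HasDensity P n (Ψ (suc o))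
                     (gf (multiplicityRows c b) (λ v → suc o * vsum v)
                         (λ v → boolToℕ (isOdd (suc o) ∨ allZero v)))
                     (gf (multiplicityRows c b) (λ v → suc o * vsum v)
                         (λ v → guarded (isOdd (suc o) ∨ allZero v) (σ (suc o) v)))) →
    HasDensity P n (sumRange 0 n Ψ) (gf (allTables n c b) weight (λ v → boolToℕ (oddParts v)))
                                    (gf (allTables n c b) weight (λ v → guarded (oddParts v) (Σ 0 v)))
  oddTables-density σ Σ Σ-[] Σ-∷ rows =
    vectors-density (multiplicityRows c b) (λ j v → j * vsum v) (λ off v → weightFrom off v) (λ _ → refl) (λ _ _ _ → refl)
      (λ j row → isOdd j ∨ allZero row) (λ off v → oddPartsFrom off v) (λ _ → refl) oddPartsFrom-∷
      σ Σ Σ-[] Σ-∷ rows n 0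

module _ (c b n : ℕ) where

  plainTables-count : gf (allTables n c b) weight (λ _ → 1) ≗ prodRange 0 n (λ j → power c (partGF j b (λ _ → 1)))
  plainTables-count d =
    trans (vectors-count (multiplicityRows c b) (λ j v → j * vsum v) (λ off v → weightFrom off v) (λ _ → refl) (λ _ _ _ → refl)
             (λ _ _ → true) (λ _ _ → true) (λ _ → refl) (λ _ _ _ → refl) n 0 d)
          (prodRange-≗ 0 n (λ o → row-count (upTo (suc b)) (suc o) (λ _ → true) (λ _ → true) refl (λ _ _ → refl) c) d)

  oddTables-count : gf (allTables n c b) weight (λ v → boolToℕ (oddParts v))
                  ≗ prodRange 0 n (λ j → power c (partGF j b (oddPartCount (isOdd j))))
  oddTables-count d =
    trans (vectors-count (multiplicityRows c b) (λ j v → j * vsum v) (λ off v → weightFrom off v) (λ _ → refl) (λ _ _ _ → refl)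
             (λ j row → isOdd j ∨ allZero row) (λ off v → oddPartsFrom off v) (λ _ → refl) oddPartsFrom-∷ n 0 d)
          (prodRange-≗ 0 n (λ o → row-count (upTo (suc b)) (suc o) (λ x → isOdd (suc o) ∨ (x ≡ᵇ 0))
                                    (λ v → isOdd (suc o) ∨ allZero v) (∨-zeroʳ (isOdd (suc o)))
                                    (λ x v → ∨-distribˡ-∧ (isOdd (suc o)) (x ≡ᵇ 0) (allZero v)) c) d)

goSeries : ℕ → ℕ → ℕ → ℕ → Series
goSeries r s k n = gf (pairs (allTables n r n) (allTables n s n)) pairWeight
                      (λ p → guarded (oddParts (proj₂ p)) (distinctAtLeast k (proj₂ p)))

overpartitionCount oddOverlinedCount : ℕ → ℕ → ℕ → Series
overpartitionCount r s n = gf (pairs (allTables n r n) (allTables n s 1)) pairWeight (λ _ → 1)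
oddOverlinedCount  r s n = gf (pairs (allTables n r n) (allTables n s n)) pairWeight (λ p → boolToℕ (oddParts (proj₂ p)))

module _ (r s n : ℕ) where

  private
    λT = allTables n r n
    μT = allTables n s 1
    νT = allTables n s n

  overpartitionCount≈oddOverlinedCount : overpartitionCount r s n ≈[ n ] oddOverlinedCount r s n
  overpartitionCount≈oddOverlinedCount = begin
    overpartitionCount r s n
      ≈⟨ ≗⇒≈ (pairs-count λT μT weight weight (λ _ → 1)) ⟩
    λCount ⊛ gf μT weight (λ _ → 1)
      ≈⟨ ⊛-cong {λCount} ≈-refl (≗⇒≈ (plainTables-count s 1 n)) ⟩
    λCount ⊛ prodRange 0 n (distinctRow s n)
      ≈⟨ ⊛-cong {λCount} ≈-refl (euler s n) ⟩
    λCount ⊛ prodRange 0 n (oddRow s n)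
      ≈⟨ ⊛-cong {λCount} ≈-refl (≗⇒≈ (oddTables-count s n n)) ⟨
    λCount ⊛ gf νT weight (λ v → boolToℕ (oddParts v))
      ≈⟨ ≗⇒≈ (pairs-count λT νT weight weight (λ v → boolToℕ (oddParts v))) ⟨
    oddOverlinedCount r s n
      ∎
    where
    open ≈-Reasoning n
    λCount = gf λT weight (λ _ → 1)

module _ (r s k : ℕ) .{{_ : NonZero k}} (n : ℕ) where

  private
    A = geometric⁺ k n
    λT = allTables n r n
    μT = allTables n s 1
    νT = allTables n s n

    sizeRow : ∀ U c o {P Ψ} → HasDensity P n Ψ (gf U (suc o *_) (λ _ → 1)) (gf U (suc o *_) (guarded (suc o ≡ᵇ k))) →
              HasDensity P n (scale c Ψ) (gf (allVec U c) (λ v → suc o * vsum v) (λ _ → 1))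
                                         (gf (allVec U c) (λ v → suc o * vsum v) (λ v → guarded (suc o ≡ᵇ k) (vsum v)))
    sizeRow U c o entry = row-density U (suc o) (λ _ → true) (λ _ → true) refl (λ _ _ → refl)
      (guarded (suc o ≡ᵇ k)) (λ v → guarded (suc o ≡ᵇ k) (vsum v))
      (guarded-0 _) (λ x v → guarded-+ (suc o ≡ᵇ k) x (vsum v)) entry c

    oddRow-density : ∀ (σ : ℕ → ℕ → ℕ) (Σ : ℕ → ∀ {l} → Vec ℕ l → ℕ) → (∀ j → Σ j [] ≡ 0) →
      (∀ j {l} x (v : Vec ℕ l) → Σ j (x ∷ v) ≡ σ j x + Σ j v) → ∀ {Ψ : ℕ → Series} →
      (∀ o → HasDensity 1ˢ n (Ψ (suc o)) (partGF (suc o) n (oddPartCount (isOdd (suc o))))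
                                         (partGF (suc o) n (λ x → guarded (isOdd (suc o) ∨ (x ≡ᵇ 0)) (σ (suc o) x)))) →
      ∀ o → HasDensity 1ˢ n (scale s (Ψ (suc o)))
              (gf (multiplicityRows s n) (λ v → suc o * vsum v) (λ v → boolToℕ (isOdd (suc o) ∨ allZero v)))
              (gf (multiplicityRows s n) (λ v → suc o * vsum v) (λ v → guarded (isOdd (suc o) ∨ allZero v) (Σ (suc o) v)))
    oddRow-density σ Σ Σ-[] Σ-∷ entry o =
      row-density (upTo (suc n)) (suc o) (λ x → isOdd (suc o) ∨ (x ≡ᵇ 0)) (λ v → isOdd (suc o) ∨ allZero v)
        (∨-zeroʳ (isOdd (suc o))) (λ x v → ∨-distribˡ-∧ (isOdd (suc o)) (x ≡ᵇ 0) (allZero v))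
        (σ (suc o)) (Σ (suc o)) (Σ-[] (suc o)) (Σ-∷ (suc o)) (entry o) s

    indicator-sum : ∀ c Z → (n < k → Z ≈[ n ] 0ˢ) → sumRange 0 n (λ j → scale c (indicator k Z j)) ≈[ n ] scale c Z
    indicator-sum c Z Z≈0 =
      ≈-trans (≗⇒≈ (sumRange-scale 0 n c (indicator k Z))) (scale-cong c (sumRange-indicator k Z (>-nonZero⁻¹ k) Z≈0))

  F-density : HasDensity 1ˢ n (scale r A) (overpartitionCount r s n)
                              (gf (pairs λT μT) pairWeight (λ p → partsOfSize k (proj₁ p)))
  F-density = pairs-density-left λT μT weight weight (partsOfSize k)
    (density-cong (indicator-sum r A (shift-vanishes k _)) (λ _ → refl) (λ _ → refl)
      (plainTables-density (λ j row → guarded (j ≡ᵇ k) (vsum row)) (λ off v → partsOfSizeFrom k off v)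
         (λ _ → refl) (λ _ _ _ → refl) {Ψ = λ j → scale r (indicator k A j)}
         (λ o → sizeRow (upTo (suc n)) r o (entry-size k n o))))

  G-density : HasDensity 1ˢ n (scale r A) (overpartitionCount r s n)
                              (gf (pairs λT μT) pairWeight (λ p → distinctAtLeast k (proj₁ p)))
  G-density = pairs-density-left λT μT weight weight (distinctAtLeast k)
    (density-cong (≈-trans (≗⇒≈ (sumRange-scale 0 n r (λ j → shift (j * k) 1ˢ))) (scale-cong r (geometric⁺-as-sum k n)))
                  (λ _ → refl) (λ _ → refl)
      (plainTables-density (λ _ row → countAtLeast k row) (λ _ v → distinctAtLeast k v)
         (λ _ → refl) (λ _ _ _ → refl) {Ψ = λ j → scale r (shift (j * k) 1ˢ)}
         (λ o → row-density (upTo (suc n)) (suc o) (λ _ → true) (λ _ → true) refl (λ _ _ → refl)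
                  (atLeast k) (countAtLeast k) refl (λ _ _ → refl) (entry-atLeast k n o) r)))

  Fd-density : HasDensity (1ˢ ⊞ shift k 1ˢ) n (scale s (shift k 1ˢ)) (overpartitionCount r s n)
                                             (gf (pairs λT μT) pairWeight (λ p → partsOfSize k (proj₂ p)))
  Fd-density = pairs-density-right λT μT weight weight (λ _ → 1) (partsOfSize k)
    (density-cong (indicator-sum s (shift k 1ˢ) (shift-vanishes k _)) (λ _ → refl) (λ _ → refl)
      (plainTables-density (λ j row → guarded (j ≡ᵇ k) (vsum row)) (λ off v → partsOfSizeFrom k off v)
         (λ _ → refl) (λ _ _ _ → refl) {Ψ = λ j → scale s (indicator k (shift k 1ˢ) j)}
         (λ o → sizeRow (upTo 2) s o (entry-distinct-size k n o))))

  Go-density : HasDensity 1ˢ n (scale s (oddSum k n)) (oddOverlinedCount r s n) (goSeries r s k n)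
  Go-density = pairs-density-right λT νT weight weight
    (λ v → boolToℕ (oddParts v)) (λ v → guarded (oddParts v) (distinctAtLeast k v))
    (density-cong (≗⇒≈ (sumRange-scale 0 n s (oddTerm k))) (λ _ → refl) (λ _ → refl)
      (oddTables-density (λ _ row → countAtLeast k row) (λ _ v → distinctAtLeast k v)
         (λ _ → refl) (λ _ _ _ → refl) {Ψ = λ j → scale s (oddTerm k j)}
         (oddRow-density (λ _ → atLeast k) (λ _ v → countAtLeast k v) (λ _ → refl) (λ _ _ _ → refl)
                         {Ψ = oddTerm k} (entry-odd-atLeast k n))))

  Fo-density : isOdd k ≡ true →
    HasDensity 1ˢ n (scale s A) (oddOverlinedCount r s n)
                    (gf (pairs λT νT) pairWeight (λ p → guarded (oddParts (proj₂ p)) (partsOfSize k (proj₂ p))))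
  Fo-density k-odd = pairs-density-right λT νT weight weight
    (λ v → boolToℕ (oddParts v)) (λ v → guarded (oddParts v) (partsOfSize k v))
    (density-cong (≈-trans (≗⇒≈ (sumRange-≗ 0 n (λ j i → cong (s *_) (odd-indicator j i))))
                           (indicator-sum s A (shift-vanishes k _)))
                  (λ _ → refl) (λ _ → refl)
      (oddTables-density (λ j row → guarded (j ≡ᵇ k) (vsum row)) (λ off v → partsOfSizeFrom k off v)
         (λ _ → refl) (λ _ _ _ → refl) {Ψ = λ j → scale s (if isOdd j then indicator k A j else 0ˢ)}
         (oddRow-density (λ j → guarded (j ≡ᵇ k)) (λ j v → guarded (j ≡ᵇ k) (vsum v)) (λ j → guarded-0 (j ≡ᵇ k))
                         (λ j x v → guarded-+ (j ≡ᵇ k) x (vsum v)) {Ψ = λ j → if isOdd j then indicator k A j else 0ˢ}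
                         (entry-odd-size k n))))
    where
    odd-indicator : ∀ j → (if isOdd j then indicator k A j else 0ˢ) ≗ indicator k A j
    odd-indicator j i with j ≟ k
    ... | yes refl rewrite k-odd = refl
    ... | no  j≢k  rewrite indicator-≢ k A j≢k with isOdd j
    ...   | true  = refl
    ...   | false = refl

  goSeries≈ : goSeries r s k n ≈[ n ] scale s (oddSum k n ⊛ oddOverlinedCount r s n)
  goSeries≈ = ≈-trans (density-1ˢ Go-density) (≗⇒≈ (⊛-scaleˡ s (oddSum k n) (oddOverlinedCount r s n)))

  private
    B C Y Q P Xd Wo : Series
    B  = oddSum k n
    C  = oddOverlinedCount r s n
    Y  = goSeries r s k n
    Q  = scale s (shift k C)
    P  = 1ˢ ⊞ shift k 1ˢ
    Xd = gf (pairs λT μT) pairWeight (λ p → partsOfSize k (proj₂ p))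
    Wo = gf (pairs λT νT) pairWeight (λ p → guarded (oddParts (proj₂ p)) (partsOfSize k (proj₂ p)))

    P-⊛ : ∀ f → P ⊛ f ≗ f ⊞ shift k f
    P-⊛ f i = trans (⊛-distribʳ-⊞ 1ˢ (shift k 1ˢ) f i) (cong₂ _+_ (⊛-identityˡ f i) (shift-1ˢ-⊛ k f i))

    -- Y = s B C with B = q^k / (1 - q^2k), so Y = s q^k C + q^2k Y.
    Y-rec : Y ≈[ n ] Q ⊞ shift (k + k) Y
    Y-rec = begin
      Y                                            ≈⟨ goSeries≈ ⟩
      scale s (B ⊛ C)                              ≈⟨ scale-cong s (⊛-cong (oddSum-rec k n) ≈-refl) ⟩
      scale s ((shift k 1ˢ ⊞ shift (k + k) B) ⊛ C) ≈⟨ ≗⇒≈ split ⟩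
      Q ⊞ shift (k + k) (scale s (B ⊛ C))          ≈⟨ ⊞-cong ≈-refl (shift-cong (k + k) goSeries≈) ⟨
      Q ⊞ shift (k + k) Y                          ∎
      where
      open ≈-Reasoning n
      split : scale s ((shift k 1ˢ ⊞ shift (k + k) B) ⊛ C) ≗ Q ⊞ shift (k + k) (scale s (B ⊛ C))
      split i rewrite ⊛-distribʳ-⊞ (shift k 1ˢ) (shift (k + k) B) C i | shift-1ˢ-⊛ k C i
                    | ⊛-shiftˡ (k + k) B C i | shift-scale (k + k) s (B ⊛ C) i = *-distribˡ-+ s _ _

    P⊛Xd≈Q : P ⊛ Xd ≈[ n ] Q
    P⊛Xd≈Q = begin
      P ⊛ Xd                                            ≈⟨ Fd-density ⟩
      scale s (shift k 1ˢ) ⊛ overpartitionCount r s n   ≈⟨ ⊛-cong {scale s (shift k 1ˢ)} ≈-refl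
                                                                  (overpartitionCount≈oddOverlinedCount r s n) ⟩
      scale s (shift k 1ˢ) ⊛ C                          ≈⟨ ≗⇒≈ (λ i → trans (⊛-scaleˡ s (shift k 1ˢ) C i)
                                                                            (cong (s *_) (shift-1ˢ-⊛ k C i))) ⟩
      Q                                                 ∎
      where open ≈-Reasoning n

    -- P = 1 + q^k is invertible, and P Fd = s q^k C = P Y - q^k P Y by Y-rec.
    Fd-rec : Xd ⊞ shift k Y ≈[ n ] Y
    Fd-rec = ⊛-cancelˡ {P} (cong (1 +_) (shift-below k 1ˢ (>-nonZero⁻¹ k))) (begin
      P ⊛ (Xd ⊞ shift k Y)              ≈⟨ ≗⇒≈ (λ i → trans (⊛-distribˡ-⊞ P Xd (shift k Y) i)
                                                          (cong ((P ⊛ Xd) i +_) (⊛-shiftʳ k P Y i))) ⟩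
      P ⊛ Xd ⊞ shift k (P ⊛ Y)          ≈⟨ ⊞-cong P⊛Xd≈Q (≗⇒≈ (shift-≗ k (P-⊛ Y))) ⟩
      Q ⊞ shift k (Y ⊞ shift k Y)       ≈⟨ ≗⇒≈ rearrange ⟩
      Q ⊞ shift (k + k) Y ⊞ shift k Y   ≈⟨ ⊞-cong Y-rec ≈-refl ⟨
      Y ⊞ shift k Y                     ≈⟨ ≗⇒≈ (P-⊛ Y) ⟨
      P ⊛ Y                             ∎)
      where
      open ≈-Reasoning n
      rearrange : Q ⊞ shift k (Y ⊞ shift k Y) ≗ Q ⊞ shift (k + k) Y ⊞ shift k Y
      rearrange i rewrite shift-⊞ k Y (shift k Y) i | shift-+ k k Y i =
        trans (cong (Q i +_) (+-comm (shift k Y i) _)) (sym (+-assoc (Q i) _ _))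

    Fo-rec : isOdd k ≡ true → Wo ≈[ n ] Y ⊞ shift k Y
    Fo-rec k-odd = begin
      Wo                                            ≈⟨ density-1ˢ (Fo-density k-odd) ⟩
      scale s A ⊛ C                                 ≈⟨ ⊛-cong (scale-cong s (oddSum-⊞-shift k n)) ≈-refl ⟨
      scale s (B ⊞ shift k B) ⊛ C                   ≈⟨ ≗⇒≈ split ⟩
      scale s (B ⊛ C) ⊞ shift k (scale s (B ⊛ C))   ≈⟨ ⊞-cong goSeries≈ (shift-cong k goSeries≈) ⟨
      Y ⊞ shift k Y                                 ∎
      where
      open ≈-Reasoning n
      split : scale s (B ⊞ shift k B) ⊛ C ≗ scale s (B ⊛ C) ⊞ shift k (scale s (B ⊛ C))
      split i rewrite ⊛-scaleˡ s (B ⊞ shift k B) C i | ⊛-distribʳ-⊞ B (shift k B) C i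
                    | ⊛-shiftˡ k B C i | shift-scale k s (B ⊛ C) i = *-distribˡ-+ s _ _

    if-∧ : ∀ a b x → (if a ∧ b then x else 0) ≡ (if a then guarded b x else 0)
    if-∧ true  b x = refl
    if-∧ false b x = refl

  goSeries-at-0 : goSeries r s k n 0 ≡ 0
  goSeries-at-0 = begin
    Y 0
      ≡⟨ Y-rec 0 z≤n ⟩
    s * shift k C 0 + shift (k + k) Y 0
      ≡⟨ cong₂ (λ a b → s * a + b) (shift-below k C 0<k) (shift-below (k + k) Y 0<k+k) ⟩
    s * 0 + 0
      ≡⟨ cong (_+ 0) (*-zeroʳ s) ⟩
    0
      ∎
    where
    open ≡-Reasoning
    0<k = >-nonZero⁻¹ k
    0<k+k = ≤-trans 0<k (m≤m+n k k)

  Go≡goSeries : Go r s k n ≡ goSeries r s k n n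
  Go≡goSeries = sum-filter≡gf (pairs λT νT) _ _ pairWeight _ n
                  (λ { (l , v) → if-∧ (weight l + weight v ≡ᵇ n) (oddParts v) (distinctAtLeast k v) })

  F≡G : F r s k n ≡ G r s k n
  F≡G = begin
    F r s k n
      ≡⟨ sum-filter≡gf (pairs λT μT) _ _ pairWeight (λ p → partsOfSize k (proj₁ p)) n (λ { (l , m) → refl }) ⟩
    gf (pairs λT μT) pairWeight (λ p → partsOfSize k (proj₁ p)) n
      ≡⟨ density-1ˢ F-density n ≤-refl ⟩
    (scale r A ⊛ overpartitionCount r s n) n
      ≡⟨ density-1ˢ G-density n ≤-refl ⟨
    gf (pairs λT μT) pairWeight (λ p → distinctAtLeast k (proj₁ p)) n
      ≡⟨ sum-filter≡gf (pairs λT μT) _ _ pairWeight (λ p → distinctAtLeast k (proj₁ p)) n (λ { (l , m) → refl }) ⟨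
    G r s k n
      ∎
    where open ≡-Reasoning

  Fd+shifted≡Go : Fd r s k n + shift k (goSeries r s k n) n ≡ Go r s k n
  Fd+shifted≡Go = begin
    Fd r s k n + shift k Y n
      ≡⟨ cong (_+ shift k Y n) Fd≡Xd ⟩
    Xd n + shift k Y n
      ≡⟨ Fd-rec n ≤-refl ⟩
    Y n
      ≡⟨ Go≡goSeries ⟨
    Go r s k n
      ∎
    where
    open ≡-Reasoning
    Fd≡Xd : Fd r s k n ≡ Xd n
    Fd≡Xd = sum-filter≡gf (pairs λT μT) _ _ pairWeight _ n (λ { (l , m) → refl })

  Fo≡Go+shifted : isOdd k ≡ true → Fo r s k n ≡ Go r s k n + shift k (goSeries r s k n) n
  Fo≡Go+shifted k-odd = begin
    Fo r s k n                 ≡⟨ sum-filter≡gf (pairs λT νT) _ _ pairWeight _ n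
                                    (λ { (l , v) → if-∧ (weight l + weight v ≡ᵇ n) (oddParts v) (partsOfSize k v) }) ⟩
    Wo n                       ≡⟨ Fo-rec k-odd n ≤-refl ⟩
    Y n + shift k Y n          ≡⟨ cong (_+ shift k Y n) Go≡goSeries ⟨
    Go r s k n + shift k Y n   ∎
    where open ≡-Reasoning

-- Independence of the truncation

module _ (r s : ℕ) {m n : ℕ} (m≤n : m ≤ n) where

  private
    λRow-stable : ∀ o → power r (geometric (suc o) m) ≈[ m ] power r (geometric (suc o) n)
    λRow-stable o = power-cong r (geometric-stable (suc o) m≤n)

    λRow-trivial : ∀ o → m ≤ o → power r (geometric (suc o) n) ≈[ m ] 1ˢ
    λRow-trivial o m≤o = ≈-trans (power-cong r (geometric-trivial (suc o) m≤n (s≤s m≤o))) (≗⇒≈ (power-1ˢ r))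

    oddRow-stable : ∀ o → oddRow s m (suc o) ≈[ m ] oddRow s n (suc o)
    oddRow-stable o with isOdd (suc o)
    ... | true  = power-cong s (geometric-stable (suc o) m≤n)
    ... | false = ≗⇒≈ λ i → trans (power-≗ s (partGF-only-zero (suc o) m) i)
                                   (sym (power-≗ s (partGF-only-zero (suc o) n) i))

    oddRow-trivial : ∀ o → m ≤ o → oddRow s n (suc o) ≈[ m ] 1ˢ
    oddRow-trivial o m≤o with isOdd (suc o)
    ... | true  = ≈-trans (power-cong s (geometric-trivial (suc o) m≤n (s≤s m≤o))) (≗⇒≈ (power-1ˢ s))
    ... | false = ≗⇒≈ λ i → trans (power-≗ s (partGF-only-zero (suc o) n) i) (power-1ˢ s i)

    factor : ∀ b → oddOverlinedCount r s b ≗ prodRange 0 b (λ j → power r (geometric j b)) ⊛ prodRange 0 b (oddRow s b)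
    factor b i = trans (pairs-count (allTables b r b) (allTables b s b) weight weight (λ v → boolToℕ (oddParts v)) i)
                       (⊛-cong-≗ (plainTables-count r b b) (oddTables-count s b b) i)

  oddOverlinedCount-stable : oddOverlinedCount r s m ≈[ m ] oddOverlinedCount r s n
  oddOverlinedCount-stable = begin
    oddOverlinedCount r s m
      ≈⟨ ≗⇒≈ (factor m) ⟩
    prodRange 0 m (λ j → power r (geometric j m)) ⊛ prodRange 0 m (oddRow s m)
      ≈⟨ ⊛-cong (prodRange-stable m≤n λRow-stable λRow-trivial) (prodRange-stable m≤n oddRow-stable oddRow-trivial) ⟩
    prodRange 0 n (λ j → power r (geometric j n)) ⊛ prodRange 0 n (oddRow s n)
      ≈⟨ ≗⇒≈ (factor n) ⟨
    oddOverlinedCount r s n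
      ∎
    where open ≈-Reasoning m

module _ (r s k : ℕ) .{{_ : NonZero k}} {m n : ℕ} (m≤n : m ≤ n) where

  oddSum-stable : oddSum k m ≈[ m ] oddSum k n
  oddSum-stable = shift-fixpoint-unique (k + k) {{>-nonZero (≤-trans (>-nonZero⁻¹ k) (m≤m+n k k))}}
                    (oddSum-rec k m) (≈-restrict m≤n (oddSum-rec k n))

  goSeries-stable : goSeries r s k m ≈[ m ] goSeries r s k n
  goSeries-stable = begin
    goSeries r s k m
      ≈⟨ goSeries≈ r s k m ⟩
    scale s (oddSum k m ⊛ oddOverlinedCount r s m)
      ≈⟨ scale-cong s (⊛-cong oddSum-stable (oddOverlinedCount-stable r s m≤n)) ⟩
    scale s (oddSum k n ⊛ oddOverlinedCount r s n)
      ≈⟨ ≈-restrict m≤n (goSeries≈ r s k n) ⟨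
    goSeries r s k n
      ∎
    where open ≈-Reasoning m

-- The tables for Go r s k (n - k) are smaller than those for Go r s k n; stability bridges the two.
shifted-goSeries≡GoShift : ∀ r s k .{{_ : NonZero k}} n → shift k (goSeries r s k n) n ≡ GoShift r s k n
shifted-goSeries≡GoShift r s k n with k <ᵇ n | <ᵇ⇒< k n | <⇒<ᵇ {k} {n}
... | true  | k<n | _ = begin
  shift k (goSeries r s k n) n      ≡⟨ shift-apply k _ (<⇒≤ (k<n tt)) ⟩
  goSeries r s k n (n ∸ k)          ≡⟨ goSeries-stable r s k (m∸n≤m n k) (n ∸ k) ≤-refl ⟨
  goSeries r s k (n ∸ k) (n ∸ k)    ≡⟨ Go≡goSeries r s k (n ∸ k) ⟨
  Go r s k (n ∸ k)                  ∎
  where open ≡-Reasoning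
... | false | _ | k≮n with m≤n⇒m<n∨m≡n (≮⇒≥ k≮n)
...   | inj₁ n<k  = shift-below k _ n<k
...   | inj₂ refl = trans (shift-apply k _ ≤-refl) (trans (cong (goSeries r s k k) (n∸n≡0 k)) (goSeries-at-0 r s k k))

%2≡1⇒isOdd : ∀ k → k % 2 ≡ 1 → isOdd k ≡ true
%2≡1⇒isOdd (suc zero)    _   = refl
%2≡1⇒isOdd (suc (suc k)) odd = %2≡1⇒isOdd k odd

open import Data.Integer using (+_; _-_; _⊖_) renaming (_+_ to _⊕_)
open import Data.Integer.Properties using ([+m]-[+n]≡m⊖n; ⊖-≥)

m+n≡o⇒+m≡+o-+n : ∀ {m n o} → m + n ≡ o → + m ≡ + o - + n
m+n≡o⇒+m≡+o-+n {m} {n} refl = sym (begin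
  + (m + n) - + n   ≡⟨ [+m]-[+n]≡m⊖n (m + n) n ⟩
  (m + n) ⊖ n       ≡⟨ ⊖-≥ (m≤n+m n m) ⟩
  + (m + n ∸ n)     ≡⟨ cong +_ (m+n∸n≡m m n) ⟩
  + m               ∎)
  where open ≡-Reasoning

theorem7 : (r s : ℕ) → 1 ≤ r → 1 ≤ s → (n : ℕ) → 1 ≤ n →
    ((k : ℕ) → 1 ≤ k → F r s k n ≡ G r s k n)
    × ((k : ℕ) → 1 ≤ k → + Fd r s k n ≡ + Go r s k n - + GoShift r s k n)
    × ((k : ℕ) → k % 2 ≡ 1 → + Fo r s k n ≡ + Go r s k n ⊕ + GoShift r s k n)
theorem7 r s _ _ n _ = F≡G-at , Fd-at , Fo-at
  where
  F≡G-at : (k : ℕ) → 1 ≤ k → F r s k n ≡ G r s k n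
  F≡G-at (suc k) _ = F≡G r s (suc k) n

  Fd-at : (k : ℕ) → 1 ≤ k → + Fd r s k n ≡ + Go r s k n - + GoShift r s k n
  Fd-at (suc k) _ = m+n≡o⇒+m≡+o-+n (begin
    Fd r s (suc k) n + GoShift r s (suc k) n
      ≡⟨ cong (λ x → Fd r s (suc k) n + x) (shifted-goSeries≡GoShift r s (suc k) n) ⟨
    Fd r s (suc k) n + shift (suc k) (goSeries r s (suc k) n) n
      ≡⟨ Fd+shifted≡Go r s (suc k) n ⟩
    Go r s (suc k) n
      ∎)
    where open ≡-Reasoning

  Fo-at : (k : ℕ) → k % 2 ≡ 1 → + Fo r s k n ≡ + Go r s k n ⊕ + GoShift r s k n
  Fo-at (suc k) odd = cong +_ (begin
    Fo r s (suc k) n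
      ≡⟨ Fo≡Go+shifted r s (suc k) n (%2≡1⇒isOdd (suc k) odd) ⟩
    Go r s (suc k) n + shift (suc k) (goSeries r s (suc k) n) n
      ≡⟨ cong (λ x → Go r s (suc k) n + x) (shifted-goSeries≡GoShift r s (suc k) n) ⟩
    Go r s (suc k) n + GoShift r s (suc k) n
      ∎)
    where open ≡-Reasoning
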